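{- Let $r\ge1$ and $k=m_0>m_1>\dots>m_r>m_{r+1}=0$ be integers, and put $d_{ij}=m_i-m_j$. Then $$\bigl(1-xR_{d_{01}-1}(x)-xR_{m_r}(x)\bigr)G_{[m_0,\dots,m_r]}(x)=x\,G_{[d_{01}-1]}^{[d_{02},d_{12}]}(x)\,G^{[m_0,\dots,m_r]}_{[m_1,\dots,m_r]}(x)+x\sum_{j=2}^rG_{[d_{0j},\dots,d_{j-1,j}]}^{[d_{0,j+1},\dots,d_{j,j+1}]}(x)\,G^{[m_{j-1},\dots,m_r]}_{[m_j,\dots,m_r]}(x).$$
   Context: An occurrence of a pattern $\tau\in S_k$ in $\alpha\in S_n$ is a choice of indices $1\le i_1<\dots<i_k\le n$ with $(\alpha_{i_1},\dots,\alpha_{i_k})$ order-isomorphic to $\tau$; $\alpha$ contains $\tau$ exactly once if there is exactly one occurrence, and avoids $\tau$ if there is none. $g_\tau(n)$ is the number of permutations in $S_n$ that avoid $132$ and contain $\tau$ exactly once; $g^\rho_\tau(n)$ is the number of permutations in $S_n$ that avoid both $132$ and $\rho$ and contain $\tau$ exactly once; $G_\tau(x)=\sum_{n\ge0}g_\tau(n)x^n$ and $G_\tau^\rho(x)=\sum_{n\ge0}g_\tau^\rho(n)x^n$. Layered patterns: for integers $p_0>p_1>\dots>p_q>p_{q+1}=0$, $[p_0,\dots,p_q]$ is the permutation of $\{1,\dots,p_0\}$ obtained by concatenating the increasing blocks $(p_{i+1}+1,\dots,p_i)$, $i=0,\dots,q$; in particular $[p]=(1,2,\dots,p)$ and $[0]$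 is the empty pattern. Convention: $G^\rho_{[0]}(x)=1$ for the empty pattern $[0]$. $U_p$ is the Chebyshev polynomial of the second kind, $U_p(\cos\theta)=\sin((p+1)\theta)/\sin\theta$, $U_{ -1}=0$, and for $p\ge0$, $R_p(x)=\dfrac{U_{p-1}\left(\frac1{2\sqrt x}\right)}{\sqrt x\,U_p\left(\frac1{2\sqrt x}\right)}$ (so $R_0=0$). -}

module Defs where

open import Data.Nat as ℕ using (ℕ; zero; suc; _∸_; _<ᵇ_)
open import Data.Integer as ℤ using (ℤ; +_; -_)
open import Data.Bool using (Bool; true; false; not; _∧_; _xor_; if_then_else_)
open import Data.List using (List; []; _∷_; _++_; map; length; concatMap; filterᵇ; zip)
open import Data.Bool.ListAction using (and)
open import Data.Vec using (Vec; []; _∷_; lookup)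
open import Data.Fin using (Fin; fromℕ<)
open import Data.Product using (_×_; _,_; proj₁; proj₂)

PS : Set
PS = ℕ → ℤ

0S : PS
0S _ = + 0

1S : PS
1S zero    = + 1
1S (suc _) = + 0

_⊕_ : PS → PS → PS
(f ⊕ g) n = f n ℤ.+ g n
infixl 6 _⊕_ _⊖_

_⊖_ : PS → PS → PS
(f ⊖ g) n = f n ℤ.- g n

Σto : ℕ → (ℕ → ℤ) → ℤ
Σto zero    h = h 0
Σto (suc n) h = Σto n h ℤ.+ h (suc n)

_⊛_ : PS → PS → PS
(f ⊛ g) n = Σto n (λ i → f i ℤ.* g (n ∸ i))
infixl 7 _⊛_

xS : PS → PS
xS f zero    = + 0
xS f (suc n) = f n

-- multiplicative inverse of a series f, assuming f 0 = 1:
-- c 0 = 1,  c (n+1) = - Σ_{i=0}^{n} f (i+1) * c (n - i).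
-- invRev f n = [c n, c (n-1), ..., c 0]
invRev : PS → (n : ℕ) → Vec ℤ (suc n)
invRev f zero    = + 1 ∷ []
invRev f (suc n) =
  let v = invRev f n in
  (- Σto n (λ i → f (suc i) ℤ.* lookupℕ v i)) ∷ v
  where
  lookupℕ : ∀ {k} → Vec ℤ (suc k) → ℕ → ℤ
  lookupℕ (a ∷ _)       zero    = a
  lookupℕ (a ∷ [])      (suc _) = a
  lookupℕ (_ ∷ b ∷ bs)  (suc i) = lookupℕ (b ∷ bs) i

inv : PS → PS
inv f n with invRev f n
... | c ∷ _ = c

-- V p = x^{(p-1)/2} U_{p-1}(1/(2√x)) (a polynomial in x), so that
-- V 0 = U_{-1} = 0, V 1 = 1, V (p+2) = V (p+1) - x V p,
-- and R_p(x) = U_{p-1}(1/(2√x)) / (√x U_p(1/(2√x))) = V p / V (p+1).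

V : ℕ → PS
V zero          = 0S
V (suc zero)    = 1S
V (suc (suc p)) = V (suc p) ⊖ xS (V p)

R : ℕ → PS
R p = V p ⊛ inv (V (suc p))

insertAll : ℕ → List ℕ → List (List ℕ)
insertAll x []       = (x ∷ []) ∷ []
insertAll x (y ∷ ys) = (x ∷ y ∷ ys) ∷ map (y ∷_) (insertAll x ys)

perms : ℕ → List (List ℕ)
perms zero    = [] ∷ []
perms (suc n) = concatMap (insertAll (suc n)) (perms n)

-- all subsequences, one per choice of index set
subseqs : List ℕ → List (List ℕ)
subseqs []       = [] ∷ []
subseqs (x ∷ xs) = map (x ∷_) (subseqs xs) ++ subseqs xs

_==ℕ_ : ℕ → ℕ → Bool
zero  ==ℕ zero  = true
suc a ==ℕ suc b = a ==ℕ b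
_     ==ℕ _     = false

-- same relative order on all pairs of positions
pairsOK : List (ℕ × ℕ) → Bool
pairsOK []       = true
pairsOK (p ∷ ps) = and (map (λ q → compat p q) ps) ∧ pairsOK ps
  where
  cmp : ℕ → ℕ → ℕ → ℕ → Bool
  cmp a b c d = not ((a <ᵇ b) xor (c <ᵇ d))
  compat : ℕ × ℕ → ℕ × ℕ → Bool
  compat (a , c) (b , d) = cmp a b c d ∧ cmp b a d c

orderIso : List ℕ → List ℕ → Bool
orderIso a b = (length a ==ℕ length b) ∧ pairsOK (zip a b)

occ : List ℕ → List ℕ → ℕ
occ τ α = length (filterᵇ (orderIso τ) (subseqs α))

avoids : List ℕ → List ℕ → Bool
avoids τ α = occ τ α ==ℕ 0

onceIn : List ℕ → List ℕ → Bool
onceIn τ α = occ τ α ==ℕ 1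

p132 : List ℕ
p132 = 1 ∷ 3 ∷ 2 ∷ []

count : (List ℕ → Bool) → ℕ → ℕ
count P n = length (filterᵇ P (perms n))

G : List ℕ → PS
G τ n = + count (λ α → avoids p132 α ∧ onceIn τ α) n

-- G^ρ_τ(x), with the convention G^ρ_{[0]} = 1 for the empty pattern
Gρ : List ℕ → List ℕ → PS
Gρ ρ []      = 1S
Gρ ρ (t ∷ τ) n = + count (λ α → avoids p132 α ∧ avoids ρ α ∧ onceIn (t ∷ τ) α) n

block : ℕ → ℕ → List ℕ
block a b = go (b ∸ a) (suc a)
  where
  go : ℕ → ℕ → List ℕ
  go zero    _ = []
  go (suc k) s = s ∷ go k (suc s)

layered : List ℕ → List ℕ
layered []       = []
layered (p ∷ ps) = block (nxt ps) p ++ layered ps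
  where
  nxt : List ℕ → ℕ
  nxt []      = 0
  nxt (q ∷ _) = q

-- the list  a, a+1, …, b  (empty if a > b)
range : ℕ → ℕ → List ℕ
range a b = go (suc b ∸ a) a
  where
  go : ℕ → ℕ → List ℕ
  go zero    _ = []
  go (suc k) s = s ∷ go k (suc s)

ΣS : List ℕ → (ℕ → PS) → PS
ΣS []       F = 0S
ΣS (j ∷ js) F = F j ⊕ ΣS js F

module Submission where

-- A 132-avoider of length n + 1 is α = γ′ (n+1) δ with γ′ entirely above δ and γ′, δ
-- 132-avoiders; so α corresponds to a pair (γ, δ) of 132-avoiders. The layers of
-- τ = [m₀, …, m_r] are inseparable and descending, hence every occurrence of τ in α takes
-- its first j layers from γ′ (n+1) and the remaining ones from δ: occ τ α = Σⱼ pⱼ sⱼ, where pⱼ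
-- counts occurrences of the first j layers and sⱼ of the others. This sum is 1 exactly when a
-- single j has pⱼ = sⱼ = 1, pⱼ₊₁ = 0 and sⱼ₋₁ = 0, and each such condition splits into a
-- condition on γ and one on δ. Summing over (γ, δ), the terms j = 0 and j = r + 1 give
-- R_{d₀₁-1} G and G R_{m_r} (R_k counts 132-avoiders avoiding 12⋯k) and the other j give
-- the products on the right-hand side; this linear equation for G is the theorem.

open import Defs
open import Data.Nat using (ℕ; zero; suc; _∸_; _≤_; _<_; z≤n; s≤s)
open import Data.Vec using (Vec; []; _∷_)
open import Relation.Binary.PropositionalEquality hiding ([_])

module PowerSeries where

  open import Data.Integer using (ℤ; +_; -_; _+_; _-_; _*_)
  open import Data.Integer.Properties
  open import Data.Integer.Tactic.RingSolver using (solve-∀)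
  import Data.Nat as ℕ
  import Data.Nat.Properties as ℕₚ
  open ≡-Reasoning

  infix 4 _≋_

  _≋_ : PS → PS → Set
  f ≋ g = ∀ n → f n ≡ g n

  Σto-cong : ∀ n {h g : ℕ → ℤ} → (∀ i → i ≤ n → h i ≡ g i) → Σto n h ≡ Σto n g
  Σto-cong zero    h≡g = h≡g 0 z≤n
  Σto-cong (suc n) h≡g =
    cong₂ _+_ (Σto-cong n (λ i i≤n → h≡g i (ℕₚ.m≤n⇒m≤1+n i≤n))) (h≡g (suc n) ℕₚ.≤-refl)

  Σto-distrib-+ : ∀ n (h g : ℕ → ℤ) → Σto n (λ i → h i + g i) ≡ Σto n h + Σto n g
  Σto-distrib-+ zero    h g = refl
  Σto-distrib-+ (suc n) h g = begin
    Σto n (λ i → h i + g i) + (h (suc n) + g (suc n))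
      ≡⟨ cong (_+ (h (suc n) + g (suc n))) (Σto-distrib-+ n h g) ⟩
    Σto n h + Σto n g + (h (suc n) + g (suc n))
      ≡⟨ interchange (Σto n h) (Σto n g) (h (suc n)) (g (suc n)) ⟩
    Σto n h + h (suc n) + (Σto n g + g (suc n)) ∎
    where
    interchange : ∀ a b c d → a + b + (c + d) ≡ a + c + (b + d)
    interchange = solve-∀

  Σto-neg : ∀ n (h : ℕ → ℤ) → Σto n (λ i → - h i) ≡ - Σto n h
  Σto-neg zero    h = refl
  Σto-neg (suc n) h =
    trans (cong (_+ - h (suc n)) (Σto-neg n h)) (sym (neg-distrib-+ (Σto n h) (h (suc n))))

  Σto-*ˡ : ∀ n c (h : ℕ → ℤ) → Σto n (λ i → c * h i) ≡ c * Σto n h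
  Σto-*ˡ zero    c h = refl
  Σto-*ˡ (suc n) c h =
    trans (cong (_+ c * h (suc n)) (Σto-*ˡ n c h)) (sym (*-distribˡ-+ c (Σto n h) (h (suc n))))

  Σto-*ʳ : ∀ n c (h : ℕ → ℤ) → Σto n (λ i → h i * c) ≡ Σto n h * c
  Σto-*ʳ zero    c h = refl
  Σto-*ʳ (suc n) c h =
    trans (cong (_+ h (suc n) * c) (Σto-*ʳ n c h)) (sym (*-distribʳ-+ c (Σto n h) (h (suc n))))

  Σto-zero : ∀ n (h : ℕ → ℤ) → (∀ i → h i ≡ + 0) → Σto n h ≡ + 0
  Σto-zero zero    h h≡0 = h≡0 0
  Σto-zero (suc n) h h≡0 = cong₂ _+_ (Σto-zero n h h≡0) (h≡0 (suc n))

  Σto-head : ∀ n (h : ℕ → ℤ) → Σto (suc n) h ≡ h 0 + Σto n (λ i → h (suc i))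
  Σto-head zero    h = refl
  Σto-head (suc n) h =
    trans (cong (_+ h (suc (suc n))) (Σto-head n h)) (+-assoc (h 0) _ _)

  Σto-reverse : ∀ n (h : ℕ → ℤ) → Σto n h ≡ Σto n (λ i → h (n ∸ i))
  Σto-reverse zero    h = refl
  Σto-reverse (suc n) h = begin
    Σto (suc n) h
      ≡⟨ Σto-head n h ⟩
    h 0 + Σto n (λ i → h (suc i))
      ≡⟨ cong (_+_ (h 0)) (Σto-reverse n (λ i → h (suc i))) ⟩
    h 0 + Σto n (λ i → h (suc (n ∸ i)))
      ≡⟨ +-comm (h 0) _ ⟩
    Σto n (λ i → h (suc (n ∸ i))) + h 0
      ≡⟨ cong₂ _+_ (Σto-cong n (λ i i≤n → cong h (sym (ℕₚ.+-∸-assoc 1 i≤n))))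
                   (cong h (sym (ℕₚ.n∸n≡0 n))) ⟩
    Σto (suc n) (λ i → h (suc n ∸ i)) ∎

  Σto-triangle : ∀ n (T : ℕ → ℕ → ℤ) →
    Σto n (λ i → Σto i (T i)) ≡ Σto n (λ j → Σto (n ∸ j) (λ k → T (j ℕ.+ k) j))
  Σto-triangle zero    T = refl
  Σto-triangle (suc n) T = begin
    Σto n (λ i → Σto i (T i)) + Σto (suc n) (T (suc n))
      ≡⟨ cong (_+ Σto (suc n) (T (suc n))) (Σto-triangle n T) ⟩
    Σ< + (Σto n (T (suc n)) + T (suc n) (suc n))
      ≡⟨ sym (+-assoc Σ< (Σto n (T (suc n))) (T (suc n) (suc n))) ⟩
    Σ< + Σto n (T (suc n)) + T (suc n) (suc n)
      ≡⟨ cong₂ _+_ (sym (Σto-distrib-+ n _ _))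
                   (cong (λ z → T z (suc n)) (sym (ℕₚ.+-identityʳ (suc n)))) ⟩
    Σto n (λ j → Σto (n ∸ j) (λ k → T (j ℕ.+ k) j) + T (suc n) j) + T (suc n ℕ.+ 0) (suc n)
      ≡⟨ cong₂ _+_ (Σto-cong n extend)
                   (cong (λ l → Σto l (λ k → T (suc n ℕ.+ k) (suc n))) (sym (ℕₚ.n∸n≡0 n))) ⟩
    Σto (suc n) (λ j → Σto (suc n ∸ j) (λ k → T (j ℕ.+ k) j)) ∎
    where
    Σ< = Σto n (λ j → Σto (n ∸ j) (λ k → T (j ℕ.+ k) j))
    extend : ∀ j → j ≤ n →
      Σto (n ∸ j) (λ k → T (j ℕ.+ k) j) + T (suc n) j ≡ Σto (suc n ∸ j) (λ k → T (j ℕ.+ k) j)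
    extend j j≤n rewrite ℕₚ.+-∸-assoc 1 j≤n =
      cong (λ z → Σto (n ∸ j) (λ k → T (j ℕ.+ k) j) + T z j)
           (sym (trans (ℕₚ.+-suc j (n ∸ j)) (cong suc (ℕₚ.m+[n∸m]≡n j≤n))))

  ⊛-congˡ : ∀ {f f′} g → f ≋ f′ → (f ⊛ g) ≋ (f′ ⊛ g)
  ⊛-congˡ g f≋f′ n = Σto-cong n (λ i _ → cong (_* g (n ∸ i)) (f≋f′ i))

  ⊛-congʳ : ∀ f {g g′} → g ≋ g′ → (f ⊛ g) ≋ (f ⊛ g′)
  ⊛-congʳ f g≋g′ n = Σto-cong n (λ i _ → cong (f i *_) (g≋g′ (n ∸ i)))

  ⊛-comm : ∀ f g → (f ⊛ g) ≋ (g ⊛ f)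
  ⊛-comm f g n = trans (Σto-reverse n _) (Σto-cong n (λ i i≤n →
    trans (*-comm (f (n ∸ i)) (g (n ∸ (n ∸ i))))
          (cong (λ z → g z * f (n ∸ i)) (ℕₚ.m∸[m∸n]≡n i≤n))))

  ⊛-assoc : ∀ f g h → ((f ⊛ g) ⊛ h) ≋ (f ⊛ (g ⊛ h))
  ⊛-assoc f g h n = begin
    Σto n (λ i → Σto i (λ j → f j * g (i ∸ j)) * h (n ∸ i))
      ≡⟨ Σto-cong n (λ i _ → sym (Σto-*ʳ i (h (n ∸ i)) _)) ⟩
    Σto n (λ i → Σto i (λ j → f j * g (i ∸ j) * h (n ∸ i)))
      ≡⟨ Σto-triangle n (λ i j → f j * g (i ∸ j) * h (n ∸ i)) ⟩
    Σto n (λ j → Σto (n ∸ j) (λ k → f j * g (j ℕ.+ k ∸ j) * h (n ∸ (j ℕ.+ k))))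
      ≡⟨ Σto-cong n (λ j _ → Σto-cong (n ∸ j) (λ k _ →
           trans (*-assoc (f j) _ _)
                 (cong₂ (λ a b → f j * (g a * h b)) (ℕₚ.m+n∸m≡n j k) (sym (ℕₚ.∸-+-assoc n j k))))) ⟩
    Σto n (λ j → Σto (n ∸ j) (λ k → f j * (g k * h (n ∸ j ∸ k))))
      ≡⟨ Σto-cong n (λ j _ → Σto-*ˡ (n ∸ j) (f j) _) ⟩
    Σto n (λ j → f j * Σto (n ∸ j) (λ k → g k * h (n ∸ j ∸ k))) ∎

  ⊛-distribˡ-⊕ : ∀ f g h → (f ⊛ (g ⊕ h)) ≋ ((f ⊛ g) ⊕ (f ⊛ h))
  ⊛-distribˡ-⊕ f g h n =
    trans (Σto-cong n (λ i _ → *-distribˡ-+ (f i) (g (n ∸ i)) (h (n ∸ i)))) (Σto-distrib-+ n _ _)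

  ⊛-distribʳ-⊖ : ∀ f g h → ((f ⊖ g) ⊛ h) ≋ ((f ⊛ h) ⊖ (g ⊛ h))
  ⊛-distribʳ-⊖ f g h n =
    trans (Σto-cong n (λ i _ → distrib (f i) (g i) (h (n ∸ i))))
          (trans (Σto-distrib-+ n _ _) (cong (_+_ (Σto n (λ i → f i * h (n ∸ i)))) (Σto-neg n _)))
    where
    distrib : ∀ a b c → (a - b) * c ≡ a * c + - (b * c)
    distrib = solve-∀

  ⊛-identityˡ : ∀ g → (1S ⊛ g) ≋ g
  ⊛-identityˡ g zero    = *-identityˡ (g 0)
  ⊛-identityˡ g (suc n) =
    trans (Σto-head n _)
          (trans (cong₂ _+_ (*-identityˡ (g (suc n))) (Σto-zero n _ (λ _ → refl))) (+-identityʳ _))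

  ⊛-identityʳ : ∀ g → (g ⊛ 1S) ≋ g
  ⊛-identityʳ g n = trans (⊛-comm g 1S n) (⊛-identityˡ g n)

  xS-⊛ : ∀ f g → (xS f ⊛ g) ≋ xS (f ⊛ g)
  xS-⊛ f g zero    = refl
  xS-⊛ f g (suc n) = trans (Σto-head n _) (+-identityˡ _)

  -- `inv` is computed through a `where`-bound lookup of Defs that cannot be named; the two
  -- metavariables below are solved by unification to that lookup, at its top-level call and
  -- at a general one, which makes its defining equations available.
  mutual
    invHeadLookup : PS → (n : ℕ) → Vec ℤ (suc n) → ℕ → ℤ
    invHeadLookup = _

    inv-suc-unfold : ∀ f n →
      inv f (suc n) ≡ - Σto n (λ i → f (suc i) * invHeadLookup f n (invRev f n) i)
    inv-suc-unfold f n with invRev f n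
    ... | v = refl

  mutual
    invLookup : PS → ℕ → (k : ℕ) → Vec ℤ (suc k) → ℕ → ℤ
    invLookup = _

    invHeadLookup-suc : ∀ f k a b (v : Vec ℤ k) i →
      invHeadLookup f (suc k) (a ∷ b ∷ v) (suc i) ≡ invLookup f (suc k) k (b ∷ v) i
    invHeadLookup-suc f k a b v i with suc k
    ... | p with b ∷ v
    ...   | w = refl

  invLookup-invRev : ∀ f p k i → i ≤ k → invLookup f p k (invRev f k) i ≡ inv f (k ∸ i)
  invLookup-invRev f p zero          zero          _         = refl
  invLookup-invRev f p (suc k)       zero          _         = refl
  invLookup-invRev f p (suc zero)    (suc zero)    _         = refl
  invLookup-invRev f p (suc zero)    (suc (suc i)) (s≤s ())
  invLookup-invRev f p (suc (suc k)) (suc i)       (s≤s i≤k) = invLookup-invRev f p (suc k) i i≤k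

  invHeadLookup-invRev : ∀ f n i → i ≤ n → invHeadLookup f n (invRev f n) i ≡ inv f (n ∸ i)
  invHeadLookup-invRev f zero          zero          _         = refl
  invHeadLookup-invRev f (suc n)       zero          _         = refl
  invHeadLookup-invRev f (suc zero)    (suc zero)    _         = refl
  invHeadLookup-invRev f (suc zero)    (suc (suc i)) (s≤s ())
  invHeadLookup-invRev f (suc (suc n)) (suc i)       (s≤s i≤n) =
    trans (invHeadLookup-suc f (suc n) (inv f (suc (suc n))) (inv f (suc n)) (invRev f n) i)
          (invLookup-invRev f (suc (suc n)) (suc n) i i≤n)

  inv-suc : ∀ f n → inv f (suc n) ≡ - Σto n (λ i → f (suc i) * inv f (n ∸ i))
  inv-suc f n = trans (inv-suc-unfold f n) (cong -_ (Σto-cong n (λ i i≤n →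
    cong (f (suc i) *_) (invHeadLookup-invRev f n i i≤n))))

  ⊛-inverseʳ : ∀ f → f 0 ≡ + 1 → (f ⊛ inv f) ≋ 1S
  ⊛-inverseʳ f f0≡1 zero    = cong (_* + 1) f0≡1
  ⊛-inverseʳ f f0≡1 (suc n) = begin
    Σto (suc n) (λ i → f i * inv f (suc n ∸ i))
      ≡⟨ Σto-head n _ ⟩
    f 0 * inv f (suc n) + S
      ≡⟨ cong₂ (λ a b → a * b + S) f0≡1 (inv-suc f n) ⟩
    + 1 * - S + S
      ≡⟨ cancel S ⟩
    + 0 ∎
    where
    S = Σto n (λ i → f (suc i) * inv f (n ∸ i))
    cancel : ∀ a → + 1 * - a + a ≡ + 0
    cancel = solve-∀

  V-head : ∀ k → V (suc k) 0 ≡ + 1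
  V-head zero          = refl
  V-head (suc zero)    = refl
  V-head (suc (suc k)) = cong (_- + 0) (V-head (suc k))

  module _ (L : ℕ → PS) (L-zero : L 0 ≋ 0S)
           (L-suc : ∀ k → L (suc k) ≋ (1S ⊕ xS (L k ⊛ L (suc k)))) where

    V⊛solution : ∀ k → (V (suc k) ⊛ L k) ≋ V k
    V⊛solution zero    n = trans (⊛-identityˡ (L 0) n) (L-zero n)
    V⊛solution (suc k) n = begin
      ((A ⊖ xS B) ⊛ L (suc k)) n
        ≡⟨ ⊛-distribʳ-⊖ A (xS B) (L (suc k)) n ⟩
      (A ⊛ L (suc k)) n - (xS B ⊛ L (suc k)) n
        ≡⟨ cong₂ _-_ A⊛L (xS-⊛ B (L (suc k)) n) ⟩
      A n + xS (B ⊛ L (suc k)) n - xS (B ⊛ L (suc k)) n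
        ≡⟨ cancel (A n) (xS (B ⊛ L (suc k)) n) ⟩
      A n ∎
      where
      A = V (suc k)
      B = V k
      cancel : ∀ a b → a + b - b ≡ a
      cancel = solve-∀
      A⊛xS : ∀ n → (A ⊛ xS (L k ⊛ L (suc k))) n ≡ xS (B ⊛ L (suc k)) n
      A⊛xS n = begin
        (A ⊛ xS (L k ⊛ L (suc k))) n    ≡⟨ ⊛-comm A (xS (L k ⊛ L (suc k))) n ⟩
        (xS (L k ⊛ L (suc k)) ⊛ A) n    ≡⟨ xS-⊛ (L k ⊛ L (suc k)) A n ⟩
        xS ((L k ⊛ L (suc k)) ⊛ A) n    ≡⟨ cong-xS {(L k ⊛ L (suc k)) ⊛ A} reassoc n ⟩
        xS ((A ⊛ L k) ⊛ L (suc k)) n    ≡⟨ cong-xS (⊛-congˡ (L (suc k)) (V⊛solution k)) n ⟩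
        xS (B ⊛ L (suc k)) n ∎
        where
        reassoc : ((L k ⊛ L (suc k)) ⊛ A) ≋ ((A ⊛ L k) ⊛ L (suc k))
        reassoc m = trans (⊛-comm (L k ⊛ L (suc k)) A m) (sym (⊛-assoc A (L k) (L (suc k)) m))
        cong-xS : ∀ {f g} → f ≋ g → xS f ≋ xS g
        cong-xS f≋g zero    = refl
        cong-xS f≋g (suc m) = f≋g m
      A⊛L : (A ⊛ L (suc k)) n ≡ A n + xS (B ⊛ L (suc k)) n
      A⊛L = begin
        (A ⊛ L (suc k)) n                            ≡⟨ ⊛-congʳ A (L-suc k) n ⟩
        (A ⊛ (1S ⊕ xS (L k ⊛ L (suc k)))) n          ≡⟨ ⊛-distribˡ-⊕ A 1S (xS (L k ⊛ L (suc k))) n ⟩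
        (A ⊛ 1S) n + (A ⊛ xS (L k ⊛ L (suc k))) n    ≡⟨ cong₂ _+_ (⊛-identityʳ A n) (A⊛xS n) ⟩
        A n + xS (B ⊛ L (suc k)) n ∎

    R≋solution : ∀ k → R k ≋ L k
    R≋solution k n = begin
      (V k ⊛ I) n                 ≡⟨ ⊛-congˡ {V k} I (λ m → sym (V⊛solution k m)) n ⟩
      ((W ⊛ L k) ⊛ I) n           ≡⟨ ⊛-congˡ I (⊛-comm W (L k)) n ⟩
      ((L k ⊛ W) ⊛ I) n           ≡⟨ ⊛-assoc (L k) W I n ⟩
      (L k ⊛ (W ⊛ I)) n           ≡⟨ ⊛-congʳ (L k) (⊛-inverseʳ W (V-head k)) n ⟩
      (L k ⊛ 1S) n                ≡⟨ ⊛-identityʳ (L k) n ⟩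
      L k n ∎
      where
      W = V (suc k)
      I = inv W

  xS-distrib-⊕ : ∀ f g → xS (f ⊕ g) ≋ (xS f ⊕ xS g)
  xS-distrib-⊕ f g zero    = refl
  xS-distrib-⊕ f g (suc n) = refl

  ⊛-solve-linear : ∀ A B C G → G ≋ xS (A ⊛ G ⊕ B ⊕ G ⊛ C) →
    ((1S ⊖ xS A ⊖ xS C) ⊛ G) ≋ xS B
  ⊛-solve-linear A B C G G≋ n = begin
    ((1S ⊖ xS A ⊖ xS C) ⊛ G) n
      ≡⟨ ⊛-distribʳ-⊖ (1S ⊖ xS A) (xS C) G n ⟩
    ((1S ⊖ xS A) ⊛ G) n - (xS C ⊛ G) n
      ≡⟨ cong (_- (xS C ⊛ G) n) (⊛-distribʳ-⊖ 1S (xS A) G n) ⟩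
    (1S ⊛ G) n - (xS A ⊛ G) n - (xS C ⊛ G) n
      ≡⟨ cong₂ (λ a b → a - (xS A ⊛ G) n - b) (⊛-identityˡ G n) (xS-⊛ C G n) ⟩
    G n - (xS A ⊛ G) n - xS (C ⊛ G) n
      ≡⟨ cong₂ (λ a b → a - b - xS (C ⊛ G) n) (G≋ n) (xS-⊛ A G n) ⟩
    xS (A ⊛ G ⊕ B ⊕ G ⊛ C) n - xS (A ⊛ G) n - xS (C ⊛ G) n
      ≡⟨ cancel n ⟩
    xS B n ∎
    where
    cancel : ∀ n → xS (A ⊛ G ⊕ B ⊕ G ⊛ C) n - xS (A ⊛ G) n - xS (C ⊛ G) n ≡ xS B n
    cancel zero    = refl
    cancel (suc n) = trans (cong (λ z → (A ⊛ G) n + B n + z - (A ⊛ G) n - (C ⊛ G) n) (⊛-comm G C n))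
                           (ring ((A ⊛ G) n) (B n) ((C ⊛ G) n))
      where
      ring : ∀ a b c → a + b + c - a - c ≡ b
      ring = solve-∀

open PowerSeries

open import Data.Nat using (_+_; _*_; _<ᵇ_; _<?_)
open import Data.Nat.Properties
open import Data.Nat.Tactic.RingSolver using (solve-∀)
import Data.Integer as ℤ
import Data.Integer.Properties as ℤₚ
open import Data.Bool using (Bool; true; false; not; _∧_; _xor_; if_then_else_; T)
open import Data.Bool.Properties using (∧-assoc; ∧-comm; ∧-identityʳ; ∧-zeroʳ; ∧-commutativeMonoid)
open import Data.Bool.ListAction using (and)
open import Data.Empty using (⊥-elim)
open import Data.Unit using (⊤; tt)
open import Data.Product using (_×_; _,_; proj₁; proj₂; Σ)
open import Data.Sum using (inj₁; inj₂)
open import Data.List using (List; []; _∷_; [_]; _++_; map; concatMap; filterᵇ; length; concat; zip; iterate)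
open import Data.List.Properties
  using (∷-injectiveˡ; map-cong; ++-assoc; map-++; map-∘; length-++; length-map; ++-identityʳ; concat-++; concat-map; length-iterate)
open import Data.List.Relation.Unary.All as All using (All; []; _∷_)
import Data.List.Relation.Unary.All.Properties as AllP
open import Data.List.Relation.Unary.Unique.Propositional using (Unique; []; _∷_)
open import Data.List.Relation.Binary.Sublist.Propositional using (_⊆_; []; _∷_; _∷ʳ_; ⊆-refl; ⊆-trans; to∈)
open import Data.List.Relation.Binary.Sublist.Propositional.Properties using (++⁺ˡ; ++⁺ʳ; ++⁺; []⊆-universal)
open import Function using (_∘_)
open import Relation.Binary.Definitions using (tri<; tri≈; tri>)
open import Relation.Nullary using (yes; no)
open import Algebra.Bundles using (CommutativeMonoid)
open import Algebra.Properties.CommutativeSemigroup +-commutativeSemigroup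
  using () renaming (interchange to +-interchange)
open import Algebra.Properties.CommutativeSemigroup (CommutativeMonoid.commutativeSemigroup ∧-commutativeMonoid)
  using () renaming (interchange to ∧-interchange)

ind : Bool → ℕ
ind true  = 1
ind false = 0

ind-∧ : ∀ a b → ind (a ∧ b) ≡ ind a * ind b
ind-∧ true  b = sym (+-identityʳ (ind b))
ind-∧ false b = refl

Σl : {A : Set} → List A → (A → ℕ) → ℕ
Σl []       f = 0
Σl (x ∷ xs) f = f x + Σl xs f

length-filterᵇ : {A : Set} (P : A → Bool) (L : List A) → length (filterᵇ P L) ≡ Σl L (λ x → ind (P x))
length-filterᵇ P []       = refl
length-filterᵇ P (x ∷ xs) with P x
... | true  = cong suc (length-filterᵇ P xs)
... | false = length-filterᵇ P xs

Σl-cong : {A : Set} (L : List A) {f g : A → ℕ} → (∀ x → f x ≡ g x) → Σl L f ≡ Σl L g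
Σl-cong []      f≡g = refl
Σl-cong (x ∷ L) f≡g = cong₂ _+_ (f≡g x) (Σl-cong L f≡g)

Σl-cong-All : {A : Set} {P : A → Set} {L : List A} {f g : A → ℕ} →
  All P L → (∀ x → P x → f x ≡ g x) → Σl L f ≡ Σl L g
Σl-cong-All []         f≡g = refl
Σl-cong-All (px ∷ pxs) f≡g = cong₂ _+_ (f≡g _ px) (Σl-cong-All pxs f≡g)

Σl-++ : {A : Set} (xs ys : List A) (f : A → ℕ) → Σl (xs ++ ys) f ≡ Σl xs f + Σl ys f
Σl-++ []       ys f = refl
Σl-++ (x ∷ xs) ys f = trans (cong (f x +_) (Σl-++ xs ys f)) (sym (+-assoc (f x) _ _))

Σl-map : {A B : Set} (g : A → B) (xs : List A) (f : B → ℕ) → Σl (map g xs) f ≡ Σl xs (f ∘ g)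
Σl-map g []       f = refl
Σl-map g (x ∷ xs) f = cong (f (g x) +_) (Σl-map g xs f)

Σl-concatMap : {A B : Set} (g : A → List B) (xs : List A) (f : B → ℕ) →
  Σl (concatMap g xs) f ≡ Σl xs (λ x → Σl (g x) f)
Σl-concatMap g []       f = refl
Σl-concatMap g (x ∷ xs) f =
  trans (Σl-++ (g x) (concatMap g xs) f) (cong (Σl (g x) f +_) (Σl-concatMap g xs f))

Σl-distrib-+ : {A : Set} (L : List A) (f g : A → ℕ) → Σl L (λ x → f x + g x) ≡ Σl L f + Σl L g
Σl-distrib-+ []      f g = refl
Σl-distrib-+ (x ∷ L) f g =
  trans (cong (f x + g x +_) (Σl-distrib-+ L f g)) (+-interchange (f x) (g x) (Σl L f) (Σl L g))

Σl-*ˡ : {A : Set} (L : List A) (c : ℕ) (f : A → ℕ) → Σl L (λ x → c * f x) ≡ c * Σl L f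
Σl-*ˡ []      c f = sym (*-zeroʳ c)
Σl-*ˡ (x ∷ L) c f = trans (cong (c * f x +_) (Σl-*ˡ L c f)) (sym (*-distribˡ-+ c (f x) _))

Σl-*ʳ : {A : Set} (L : List A) (c : ℕ) (f : A → ℕ) → Σl L (λ x → f x * c) ≡ Σl L f * c
Σl-*ʳ []      c f = refl
Σl-*ʳ (x ∷ L) c f = trans (cong (f x * c +_) (Σl-*ʳ L c f)) (sym (*-distribʳ-+ c (f x) _))

Σl-zero : {A : Set} (L : List A) (f : A → ℕ) → (∀ x → f x ≡ 0) → Σl L f ≡ 0
Σl-zero []      f f≡0 = refl
Σl-zero (x ∷ L) f f≡0 = cong₂ _+_ (f≡0 x) (Σl-zero L f f≡0)

Σl-swap : {A B : Set} (L : List A) (M : List B) (h : A → B → ℕ) →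
  Σl L (λ x → Σl M (h x)) ≡ Σl M (λ y → Σl L (λ x → h x y))
Σl-swap []      M h = sym (Σl-zero M _ (λ y → refl))
Σl-swap (x ∷ L) M h =
  trans (cong (Σl M (h x) +_) (Σl-swap L M h)) (sym (Σl-distrib-+ M (h x) _))

Σl-product : {A B : Set} (L : List A) (M : List B) (f : A → ℕ) (g : B → ℕ) →
  Σl L (λ x → Σl M (λ y → f x * g y)) ≡ Σl L f * Σl M g
Σl-product L M f g = trans (Σl-cong L (λ x → Σl-*ˡ M (f x) g)) (Σl-*ʳ L (Σl M g) f)

ΣΣ-distrib-+ : {A B : Set} (L : List A) (M : List B) (f g : A → B → ℕ) →
  Σl L (λ x → Σl M (λ y → f x y + g x y)) ≡ Σl L (λ x → Σl M (f x)) + Σl L (λ x → Σl M (g x))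
ΣΣ-distrib-+ L M f g = trans (Σl-cong L (λ x → Σl-distrib-+ M (f x) (g x))) (Σl-distrib-+ L _ _)

Σn : ℕ → (ℕ → ℕ) → ℕ
Σn zero    f = f 0
Σn (suc n) f = Σn n f + f (suc n)

Σn-cong : ∀ n {f g : ℕ → ℕ} → (∀ i → i ≤ n → f i ≡ g i) → Σn n f ≡ Σn n g
Σn-cong zero    f≡g = f≡g 0 z≤n
Σn-cong (suc n) f≡g = cong₂ _+_ (Σn-cong n (λ i i≤n → f≡g i (m≤n⇒m≤1+n i≤n))) (f≡g (suc n) ≤-refl)

Σn-head : ∀ n (f : ℕ → ℕ) → Σn (suc n) f ≡ f 0 + Σn n (λ i → f (suc i))
Σn-head zero    f = refl
Σn-head (suc n) f = trans (cong (_+ f (suc (suc n))) (Σn-head n f)) (+-assoc (f 0) _ _)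

Σn-distrib-+ : ∀ n (f g : ℕ → ℕ) → Σn n (λ i → f i + g i) ≡ Σn n f + Σn n g
Σn-distrib-+ zero    f g = refl
Σn-distrib-+ (suc n) f g =
  trans (cong (_+ (f (suc n) + g (suc n))) (Σn-distrib-+ n f g))
        (+-interchange (Σn n f) (Σn n g) (f (suc n)) (g (suc n)))

Σn-Σl : ∀ n {A : Set} (L : List A) (f : A → ℕ → ℕ) → Σn n (λ a → Σl L (λ j → f j a)) ≡ Σl L (λ j → Σn n (f j))
Σn-Σl zero    L f = refl
Σn-Σl (suc n) L f = trans (cong (_+ Σl L (λ j → f j (suc n))) (Σn-Σl n L f)) (sym (Σl-distrib-+ L _ _))

-- Splitting permutations at their maximum

splits : List ℕ → List (List ℕ × List ℕ)
splits []       = ([] , []) ∷ []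
splits (x ∷ xs) = ([] , x ∷ xs) ∷ map (λ (u , v) → (x ∷ u , v)) (splits xs)

insertAll-splits : ∀ x β → insertAll x β ≡ map (λ (u , v) → u ++ x ∷ v) (splits β)
insertAll-splits x []       = refl
insertAll-splits x (y ∷ ys) = cong ((x ∷ y ∷ ys) ∷_)
  (trans (cong (map (y ∷_)) (insertAll-splits x ys))
         (trans (sym (map-∘ (splits ys))) (map-∘ (splits ys))))

splits-sound : ∀ β → All (λ (u , v) → u ++ v ≡ β) (splits β)
splits-sound []      = refl ∷ []
splits-sound (x ∷ β) = refl ∷ AllP.map⁺ (All.map (cong (x ∷_)) (splits-sound β))

allBelow : List ℕ → ℕ → Bool
allBelow []      a = true
allBelow (b ∷ v) a = (b <ᵇ a) ∧ allBelow v a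

allAbove : List ℕ → List ℕ → Bool
allAbove []      v = true
allAbove (a ∷ u) v = allBelow v a ∧ allAbove u v

shift : ℕ → List ℕ → List ℕ
shift c = map (_+ c)

<ᵇ-false : ∀ {x y} → y < x → (x <ᵇ y) ≡ false
<ᵇ-false {x} {y} y<x with x <ᵇ y in eq
... | false = refl
... | true  = ⊥-elim (<-asym y<x (<ᵇ⇒< x y (subst T (sym eq) _)))

<ᵇ-true : ∀ {x y} → x < y → (x <ᵇ y) ≡ true
<ᵇ-true {x} {y} x<y with x <ᵇ y in eq
... | true  = refl
... | false = ⊥-elim (subst T eq (<⇒<ᵇ x<y))

<ᵇ≡true⇒< : ∀ {a b} → (a <ᵇ b) ≡ true → a < b
<ᵇ≡true⇒< {a} {b} eq = <ᵇ⇒< a b (subst T (sym eq) _)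

allBelow-true : ∀ {x v} → All (_< x) v → allBelow v x ≡ true
allBelow-true []           = refl
allBelow-true (b<x ∷ bs<x) rewrite <ᵇ-true b<x = allBelow-true bs<x

allBelow-weaken : ∀ v {y x} → y < x → ind (allBelow v y) * ind (allBelow v x) ≡ ind (allBelow v y)
allBelow-weaken []      y<x = refl
allBelow-weaken (b ∷ v) {y} {x} y<x with b <ᵇ y in b<ᵇy
... | false = refl
... | true rewrite <ᵇ-true (<-trans (<ᵇ≡true⇒< b<ᵇy) y<x) = allBelow-weaken v y<x

splitSum : (List ℕ → List ℕ → ℕ) → List ℕ → ℕ
splitSum F w = Σl (splits w) (λ (u , v) → ind (allAbove u v) * F u v)

splitSum-[] : ∀ F → splitSum F [] ≡ F [] []
splitSum-[] F = trans (+-identityʳ _) (+-identityʳ _)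

splitSum-∷ : ∀ F z zs →
  splitSum F (z ∷ zs) ≡ F [] (z ∷ zs) + splitSum (λ u v → ind (allBelow v z) * F (z ∷ u) v) zs
splitSum-∷ F z zs = cong₂ _+_ (+-identityʳ _) (trans (Σl-map _ (splits zs) _) (Σl-cong (splits zs)
  λ (u , v) → trans (cong (_* F (z ∷ u) v) (ind-∧ (allBelow v z) (allAbove u v)))
                    (*-swap-assoc (ind (allBelow v z)) (ind (allAbove u v)) (F (z ∷ u) v))))
  where
  *-swap-assoc : ∀ a b c → a * b * c ≡ b * (a * c)
  *-swap-assoc = solve-∀

Σ-insertAll-allBelow-zero : ∀ x y ys (K : List ℕ → ℕ) → y < x →
  Σl (insertAll x ys) (λ w → ind (allBelow w y) * K w) ≡ 0
Σ-insertAll-allBelow-zero x y []       K y<x rewrite <ᵇ-false y<x = refl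
Σ-insertAll-allBelow-zero x y (z ∷ zs) K y<x rewrite <ᵇ-false y<x =
  trans (Σl-map (z ∷_) (insertAll x zs) _)
  (trans (Σl-cong (insertAll x zs) (λ w →
            trans (cong (_* K (z ∷ w)) (ind-∧ (z <ᵇ y) (allBelow w y)))
                  (*-swap-assoc (ind (z <ᵇ y)) (ind (allBelow w y)) (K (z ∷ w)))))
         (Σ-insertAll-allBelow-zero x y zs (λ w → ind (z <ᵇ y) * K (z ∷ w)) y<x))
  where
  *-swap-assoc : ∀ a b c → a * b * c ≡ b * (a * c)
  *-swap-assoc = solve-∀

-- Inserting a new maximum x into β: in a splitting u′ ++ v′ of the result with u′ above v′,
-- either u′ is empty or x lies in u′.
module _ (x : ℕ) where

  insertSplitSum : (List ℕ → List ℕ → ℕ) → List ℕ → ℕ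
  insertSplitSum F β = Σl (splits β) (λ (u , v) → ind (allAbove u v) * Σl (insertAll x u) (λ w → F w v))

  Σ-insertAll-splitSum : ∀ β (F : List ℕ → List ℕ → ℕ) → All (_< x) β →
    Σl (insertAll x β) (splitSum F) ≡ Σl (insertAll x β) (F []) + insertSplitSum F β
  Σ-insertAll-splitSum [] F _ =
    trans (cong (_+ 0) (trans (splitSum-∷ F x []) (cong (F [] (x ∷ []) +_) (splitSum-[] (λ u v → ind (allBelow v x) * F (x ∷ u) v)))))
          (regroup (F [] (x ∷ [])) (F (x ∷ []) []))
    where
    regroup : ∀ a b → (a + 1 * b) + 0 ≡ (a + 0) + (1 * (b + 0) + 0)
    regroup = solve-∀
  Σ-insertAll-splitSum (y ∷ ys) F (y<x ∷ ys<x) = begin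
    splitSum F (x ∷ y ∷ ys) + Σl (map (y ∷_) (insertAll x ys)) (splitSum F)
      ≡⟨ cong₂ _+_ splitSum-x∷ (Σl-map (y ∷_) (insertAll x ys) (splitSum F)) ⟩
    (F [] (x ∷ y ∷ ys) + (1 * F (x ∷ []) (y ∷ ys) + splitSum Fxy ys)) + Σl (insertAll x ys) (λ w → splitSum F (y ∷ w))
      ≡⟨ cong (F [] (x ∷ y ∷ ys) + (1 * F (x ∷ []) (y ∷ ys) + splitSum Fxy ys) +_) Σ-splitSum-y∷ ⟩
    (F [] (x ∷ y ∷ ys) + (1 * F (x ∷ []) (y ∷ ys) + splitSum Fxy ys)) + (A + insertSplitSum Fy ys)
      ≡⟨ regroup (F [] (x ∷ y ∷ ys)) (F (x ∷ []) (y ∷ ys)) (splitSum Fxy ys) A (insertSplitSum Fy ys) ⟩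
    (F [] (x ∷ y ∷ ys) + A) + (1 * (F (x ∷ []) (y ∷ ys) + 0) + (splitSum Fxy ys + insertSplitSum Fy ys))
      ≡⟨ cong₂ (λ a b → (F [] (x ∷ y ∷ ys) + a) + (1 * (F (x ∷ []) (y ∷ ys) + 0) + b))
               (sym (Σl-map (y ∷_) (insertAll x ys) (F []))) (trans merge (sym (Σl-map _ (splits ys) _))) ⟩
    Σl (insertAll x (y ∷ ys)) (F []) + insertSplitSum F (y ∷ ys) ∎
    where
    open ≡-Reasoning
    Fx Fy Fxy : List ℕ → List ℕ → ℕ
    Fx  u v = ind (allBelow v x) * F (x ∷ u) v
    Fy  u v = ind (allBelow v y) * F (y ∷ u) v
    Fxy u v = ind (allBelow v y) * Fx (y ∷ u) v
    A = Σl (insertAll x ys) (λ w → F [] (y ∷ w))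
    regroup : ∀ a b c d e → (a + (1 * b + c)) + (d + e) ≡ (a + d) + (1 * (b + 0) + (c + e))
    regroup = solve-∀
    splitSum-x∷ : splitSum F (x ∷ y ∷ ys) ≡ F [] (x ∷ y ∷ ys) + (1 * F (x ∷ []) (y ∷ ys) + splitSum Fxy ys)
    splitSum-x∷ = trans (splitSum-∷ F x (y ∷ ys)) (cong (F [] (x ∷ y ∷ ys) +_)
      (trans (splitSum-∷ Fx y ys)
             (cong (λ b → ind b * F (x ∷ []) (y ∷ ys) + splitSum Fxy ys) (allBelow-true {x} {y ∷ ys} (y<x ∷ ys<x)))))
    Σ-splitSum-y∷ : Σl (insertAll x ys) (λ w → splitSum F (y ∷ w)) ≡ A + insertSplitSum Fy ys
    Σ-splitSum-y∷ = begin
      Σl (insertAll x ys) (λ w → splitSum F (y ∷ w))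
        ≡⟨ trans (Σl-cong (insertAll x ys) (λ w → splitSum-∷ F y w)) (Σl-distrib-+ (insertAll x ys) _ _) ⟩
      A + Σl (insertAll x ys) (splitSum Fy)
        ≡⟨ cong (A +_) (Σ-insertAll-splitSum ys Fy ys<x) ⟩
      A + (Σl (insertAll x ys) (Fy []) + insertSplitSum Fy ys)
        ≡⟨ cong (λ z → A + (z + insertSplitSum Fy ys)) (Σ-insertAll-allBelow-zero x y ys (F (y ∷ [])) y<x) ⟩
      A + insertSplitSum Fy ys ∎
    merge-term : ∀ u v →
      ind (allAbove u v) * Fxy u v + ind (allAbove u v) * Σl (insertAll x u) (λ w → Fy w v)
        ≡ ind (allBelow v y ∧ allAbove u v) * Σl (insertAll x (y ∷ u)) (λ w → F w v)
    merge-term u v = begin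
      g * (b * (c * F₁)) + g * Σl (insertAll x u) (λ w → b * F (y ∷ w) v)
        ≡⟨ cong (λ z → g * (b * (c * F₁)) + g * z) (Σl-*ˡ (insertAll x u) b (λ w → F (y ∷ w) v)) ⟩
      g * (b * (c * F₁)) + g * (b * S)
        ≡⟨ cong (λ z → g * z + g * (b * S)) (trans (sym (*-assoc b c F₁)) (cong (_* F₁) (allBelow-weaken v y<x))) ⟩
      g * (b * F₁) + g * (b * S)
        ≡⟨ factor g b F₁ S ⟩
      b * g * (F₁ + S)
        ≡⟨ cong (_* (F₁ + S)) (sym (ind-∧ (allBelow v y) (allAbove u v))) ⟩
      ind (allBelow v y ∧ allAbove u v) * (F₁ + S)
        ≡⟨ cong (λ z → ind (allBelow v y ∧ allAbove u v) * (F₁ + z)) (sym (Σl-map (y ∷_) (insertAll x u) (λ w → F w v))) ⟩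
      ind (allBelow v y ∧ allAbove u v) * Σl (insertAll x (y ∷ u)) (λ w → F w v) ∎
      where
      g = ind (allAbove u v)
      b = ind (allBelow v y)
      c = ind (allBelow v x)
      F₁ = F (x ∷ y ∷ u) v
      S = Σl (insertAll x u) (λ w → F (y ∷ w) v)
      factor : ∀ g b f s → g * (b * f) + g * (b * s) ≡ b * g * (f + s)
      factor = solve-∀
    merge : splitSum Fxy ys + insertSplitSum Fy ys ≡
      Σl (splits ys) (λ (u , v) → ind (allBelow v y ∧ allAbove u v) * Σl (insertAll x (y ∷ u)) (λ w → F w v))
    merge = trans (sym (Σl-distrib-+ (splits ys) _ _)) (Σl-cong (splits ys) (λ (u , v) → merge-term u v))

Bounded : ℕ → List ℕ → Set
Bounded n = All (λ x → (1 ≤ x) × (x ≤ n))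

insertAll-All : {P : ℕ → Set} → ∀ {x} β → P x → All P β → All (All P) (insertAll x β)
insertAll-All []       px _          = (px ∷ []) ∷ []
insertAll-All (y ∷ ys) px (py ∷ pys) = (px ∷ py ∷ pys) ∷ AllP.map⁺ (All.map (py ∷_) (insertAll-All ys px pys))

perms-bounded : ∀ n → All (Bounded n) (perms n)
perms-bounded zero    = [] ∷ []
perms-bounded (suc n) = AllP.concat⁺ (AllP.map⁺ (All.map (λ {β} bβ →
  insertAll-All β (s≤s z≤n , ≤-refl) (All.map (λ (1≤x , x≤n) → 1≤x , m≤n⇒m≤1+n x≤n) bβ)) (perms-bounded n)))

insertAll-length : ∀ x β → All (λ w → length w ≡ suc (length β)) (insertAll x β)
insertAll-length x []       = refl ∷ []
insertAll-length x (y ∷ ys) = refl ∷ AllP.map⁺ (All.map (cong suc) (insertAll-length x ys))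

perms-length : ∀ n → All (λ β → length β ≡ n) (perms n)
perms-length zero    = refl ∷ []
perms-length (suc n) = AllP.concat⁺ (AllP.map⁺ (All.map (λ {β} |β|≡n →
  All.map (λ |w|≡ → trans |w|≡ (cong suc |β|≡n)) (insertAll-length (suc n) β)) (perms-length n)))

insertAll-shift : ∀ c k γ → insertAll (c + k) (shift k γ) ≡ map (shift k) (insertAll c γ)
insertAll-shift c k []       = refl
insertAll-shift c k (z ∷ zs) = cong ((c + k ∷ z + k ∷ shift k zs) ∷_)
  (trans (cong (map ((z + k) ∷_)) (insertAll-shift c k zs))
         (trans (sym (map-∘ (insertAll c zs))) (map-∘ (insertAll c zs))))

maxSplitSum : ℕ → (List ℕ → List ℕ → ℕ) → ℕ
maxSplitSum n F = Σn n (λ a → Σl (perms a) (λ γ → Σl (perms (n ∸ a)) (λ δ → F (shift (n ∸ a) γ) δ)))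

Σ-perms-splitSum : ∀ n F → Σl (perms n) (splitSum F) ≡ maxSplitSum n F
Σ-perms-splitSum zero    F = trans (cong (_+ 0) (splitSum-[] F)) (cong (_+ 0) (sym (+-identityʳ (F [] []))))
Σ-perms-splitSum (suc n) F = begin
  Σl (concatMap (insertAll (suc n)) (perms n)) (splitSum F)
    ≡⟨ Σl-concatMap (insertAll (suc n)) (perms n) (splitSum F) ⟩
  Σl (perms n) (λ β → Σl (insertAll (suc n) β) (splitSum F))
    ≡⟨ Σl-cong-All (perms-bounded n) (λ β bβ →
         Σ-insertAll-splitSum (suc n) β F (All.map (λ (_ , x≤n) → s≤s x≤n) bβ)) ⟩
  Σl (perms n) (λ β → Σl (insertAll (suc n) β) (F []) + insertSplitSum (suc n) F β)
    ≡⟨ Σl-distrib-+ (perms n) _ _ ⟩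
  Σl (perms n) (λ β → Σl (insertAll (suc n) β) (F [])) + Σl (perms n) (splitSum F′)
    ≡⟨ cong₂ _+_ (sym (Σl-concatMap (insertAll (suc n)) (perms n) (F []))) (Σ-perms-splitSum n F′) ⟩
  Σl (perms (suc n)) (F []) + maxSplitSum n F′
    ≡⟨ cong₂ _+_ (sym (+-identityʳ _)) (Σn-cong n insert-max) ⟩
  Σl (perms (suc n)) (F []) + 0 + Σn n (λ a → Σl (perms (suc a)) (λ γ → Σl (perms (n ∸ a)) (λ δ → F (shift (n ∸ a) γ) δ)))
    ≡⟨ sym (Σn-head n _) ⟩
  maxSplitSum (suc n) F ∎
  where
  open ≡-Reasoning
  F′ : List ℕ → List ℕ → ℕ
  F′ u v = Σl (insertAll (suc n) u) (λ w → F w v)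
  insert-max : ∀ a → a ≤ n →
    Σl (perms a) (λ γ → Σl (perms (n ∸ a)) (λ δ → F′ (shift (n ∸ a) γ) δ))
      ≡ Σl (perms (suc a)) (λ γ → Σl (perms (n ∸ a)) (λ δ → F (shift (n ∸ a) γ) δ))
  insert-max a a≤n = begin
    Σl (perms a) (λ γ → Σl (perms (n ∸ a)) (λ δ → F′ (shift (n ∸ a) γ) δ))
      ≡⟨ Σl-cong (perms a) (λ γ → Σl-cong (perms (n ∸ a)) (λ δ → F′-shift γ δ)) ⟩
    Σl (perms a) (λ γ → Σl (perms (n ∸ a)) (λ δ → Σl (insertAll (suc a) γ) (λ w → F (shift (n ∸ a) w) δ)))
      ≡⟨ Σl-cong (perms a) (λ γ → sym (Σl-swap (insertAll (suc a) γ) (perms (n ∸ a)) _)) ⟩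
    Σl (perms a) (λ γ → Σl (insertAll (suc a) γ) (λ w → Σl (perms (n ∸ a)) (λ δ → F (shift (n ∸ a) w) δ)))
      ≡⟨ sym (Σl-concatMap (insertAll (suc a)) (perms a) _) ⟩
    Σl (perms (suc a)) (λ γ → Σl (perms (n ∸ a)) (λ δ → F (shift (n ∸ a) γ) δ)) ∎
    where
    F′-shift : ∀ γ δ → F′ (shift (n ∸ a) γ) δ ≡ Σl (insertAll (suc a) γ) (λ w → F (shift (n ∸ a) w) δ)
    F′-shift γ δ =
      trans (cong (λ z → Σl (insertAll z (shift (n ∸ a) γ)) (λ w → F w δ)) (sym (cong suc (m+[n∸m]≡n a≤n))))
      (trans (cong (λ L → Σl L (λ w → F w δ)) (insertAll-shift (suc a) (n ∸ a) γ))
             (Σl-map (shift (n ∸ a)) (insertAll (suc a) γ) (λ w → F w δ)))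

occ≡Σ : ∀ τ α → occ τ α ≡ Σl (subseqs α) (λ s → ind (orderIso τ s))
occ≡Σ τ α = length-filterᵇ (orderIso τ) (subseqs α)

Σ-subseqs-∷ : ∀ x w (f : List ℕ → ℕ) → Σl (subseqs (x ∷ w)) f ≡ Σl (subseqs w) (f ∘ (x ∷_)) + Σl (subseqs w) f
Σ-subseqs-∷ x w f = trans (Σl-++ (map (x ∷_) (subseqs w)) (subseqs w) f) (cong (_+ Σl (subseqs w) f) (Σl-map (x ∷_) (subseqs w) f))

Σ-subseqs-++ : ∀ xs ys (g : List ℕ → ℕ) →
  Σl (subseqs (xs ++ ys)) g ≡ Σl (subseqs xs) (λ s → Σl (subseqs ys) (λ t → g (s ++ t)))
Σ-subseqs-++ []       ys g = sym (+-identityʳ _)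
Σ-subseqs-++ (x ∷ xs) ys g = begin
  Σl (subseqs (x ∷ xs ++ ys)) g
    ≡⟨ Σ-subseqs-∷ x (xs ++ ys) g ⟩
  Σl (subseqs (xs ++ ys)) (g ∘ (x ∷_)) + Σl (subseqs (xs ++ ys)) g
    ≡⟨ cong₂ _+_ (Σ-subseqs-++ xs ys (g ∘ (x ∷_))) (Σ-subseqs-++ xs ys g) ⟩
  Σl (subseqs xs) (λ s → Σl (subseqs ys) (λ t → g (x ∷ s ++ t))) + Σl (subseqs xs) (λ s → Σl (subseqs ys) (λ t → g (s ++ t)))
    ≡⟨ sym (Σ-subseqs-∷ x xs _) ⟩
  Σl (subseqs (x ∷ xs)) (λ s → Σl (subseqs ys) (λ t → g (s ++ t))) ∎
  where open ≡-Reasoning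

Σ-subseqs-map : ∀ (f : ℕ → ℕ) xs (g : List ℕ → ℕ) → Σl (subseqs (map f xs)) g ≡ Σl (subseqs xs) (λ s → g (map f s))
Σ-subseqs-map f []       g = refl
Σ-subseqs-map f (x ∷ xs) g =
  trans (Σ-subseqs-∷ (f x) (map f xs) g)
  (trans (cong₂ _+_ (Σ-subseqs-map f xs (g ∘ (f x ∷_))) (Σ-subseqs-map f xs g))
         (sym (Σ-subseqs-∷ x xs _)))

subseqs-All : {P : ℕ → Set} → ∀ {xs} → All P xs → All (All P) (subseqs xs)
subseqs-All []         = [] ∷ []
subseqs-All (px ∷ pxs) = AllP.++⁺ (AllP.map⁺ (All.map (px ∷_) (subseqs-All pxs))) (subseqs-All pxs)

-- `cmp` and `compat` repeat the `where`-bound helpers of `pairsOK`, so that they agree definitionally.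
cmp : ℕ → ℕ → ℕ → ℕ → Bool
cmp a b c d = not ((a <ᵇ b) xor (c <ᵇ d))

compat : ℕ × ℕ → ℕ × ℕ → Bool
compat (a , c) (b , d) = cmp a b c d ∧ cmp b a d c

crossCompat : List (ℕ × ℕ) → List (ℕ × ℕ) → Bool
crossCompat []       qs = true
crossCompat (p ∷ ps) qs = and (map (compat p) qs) ∧ crossCompat ps qs

and-map-++ : ∀ (c : ℕ × ℕ → Bool) ps qs → and (map c (ps ++ qs)) ≡ (and (map c ps) ∧ and (map c qs))
and-map-++ c []       qs = refl
and-map-++ c (p ∷ ps) qs = trans (cong (c p ∧_) (and-map-++ c ps qs)) (sym (∧-assoc (c p) _ _))

pairsOK-++ : ∀ ps qs → pairsOK (ps ++ qs) ≡ ((pairsOK ps ∧ pairsOK qs) ∧ crossCompat ps qs)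
pairsOK-++ []       qs = sym (∧-identityʳ (pairsOK qs))
pairsOK-++ (p ∷ ps) qs =
  trans (cong₂ _∧_ (and-map-++ (compat p) ps qs) (pairsOK-++ ps qs))
        (regroup (and (map (compat p) ps)) (and (map (compat p) qs)) (pairsOK ps) (pairsOK qs) (crossCompat ps qs))
  where
  regroup : ∀ a b p q x → ((a ∧ b) ∧ ((p ∧ q) ∧ x)) ≡ (((a ∧ p) ∧ q) ∧ (b ∧ x))
  regroup false b     p q x = refl
  regroup true  false p q x = sym (∧-zeroʳ (p ∧ q))
  regroup true  true  p q x = refl

zip-++ : ∀ (τ₁ s : List ℕ) {τ₂ t : List ℕ} → length τ₁ ≡ length s → zip (τ₁ ++ τ₂) (s ++ t) ≡ (zip τ₁ s ++ zip τ₂ t)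
zip-++ []       []      _   = refl
zip-++ (a ∷ τ₁) (x ∷ s) |τ₁|≡|s| = cong ((a , x) ∷_) (zip-++ τ₁ s (suc-injective |τ₁|≡|s|))

==ℕ-refl : ∀ n → (n ==ℕ n) ≡ true
==ℕ-refl zero    = refl
==ℕ-refl (suc n) = ==ℕ-refl n

==ℕ-+ : ∀ a x y → ((a + x) ==ℕ (a + y)) ≡ (x ==ℕ y)
==ℕ-+ zero    x y = refl
==ℕ-+ (suc a) x y = ==ℕ-+ a x y

==ℕ-true : ∀ {a b} → (a ==ℕ b) ≡ true → a ≡ b
==ℕ-true {zero}  {zero}  eq = refl
==ℕ-true {suc a} {suc b} eq = cong suc (==ℕ-true eq)

==ℕ-false : ∀ {a b} → a ≢ b → (a ==ℕ b) ≡ false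
==ℕ-false {a} {b} a≢b with a ==ℕ b in eq
... | true  = ⊥-elim (a≢b (==ℕ-true eq))
... | false = refl

orderIso-++ : ∀ (τ₁ s : List ℕ) {τ₂ t : List ℕ} → length τ₁ ≡ length s →
  orderIso (τ₁ ++ τ₂) (s ++ t) ≡ ((orderIso τ₁ s ∧ orderIso τ₂ t) ∧ crossCompat (zip τ₁ s) (zip τ₂ t))
orderIso-++ τ₁ s {τ₂} {t} |τ₁|≡|s| = begin
  (length (τ₁ ++ τ₂) ==ℕ length (s ++ t)) ∧ pairsOK (zip (τ₁ ++ τ₂) (s ++ t))
    ≡⟨ cong₂ _∧_ lengths (trans (cong pairsOK (zip-++ τ₁ s |τ₁|≡|s|)) (pairsOK-++ (zip τ₁ s) (zip τ₂ t))) ⟩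
  (length τ₂ ==ℕ length t) ∧ ((pairsOK (zip τ₁ s) ∧ pairsOK (zip τ₂ t)) ∧ crossCompat (zip τ₁ s) (zip τ₂ t))
    ≡⟨ regroup (length τ₂ ==ℕ length t) (pairsOK (zip τ₁ s)) (pairsOK (zip τ₂ t)) (crossCompat (zip τ₁ s) (zip τ₂ t)) ⟩
  ((true ∧ pairsOK (zip τ₁ s)) ∧ orderIso τ₂ t) ∧ crossCompat (zip τ₁ s) (zip τ₂ t)
    ≡⟨ cong (λ b → ((b ∧ pairsOK (zip τ₁ s)) ∧ orderIso τ₂ t) ∧ crossCompat (zip τ₁ s) (zip τ₂ t))
            (sym (trans (cong (_==ℕ length s) |τ₁|≡|s|) (==ℕ-refl (length s)))) ⟩
  (orderIso τ₁ s ∧ orderIso τ₂ t) ∧ crossCompat (zip τ₁ s) (zip τ₂ t) ∎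
  where
  open ≡-Reasoning
  lengths : (length (τ₁ ++ τ₂) ==ℕ length (s ++ t)) ≡ (length τ₂ ==ℕ length t)
  lengths = trans (cong₂ _==ℕ_ (length-++ τ₁) (length-++ s))
                  (trans (cong (λ l → (l + length τ₂) ==ℕ (length s + length t)) |τ₁|≡|s|) (==ℕ-+ (length s) _ _))
  regroup : ∀ e p q x → (e ∧ ((p ∧ q) ∧ x)) ≡ (((true ∧ p) ∧ (e ∧ q)) ∧ x)
  regroup false p q x = sym (cong (_∧ x) (∧-zeroʳ p))
  regroup true  p q x = refl

orderIso-length-≢ : ∀ τ s → length τ ≢ length s → orderIso τ s ≡ false
orderIso-length-≢ τ s |τ|≢|s| rewrite ==ℕ-false |τ|≢|s| = refl

orderIso-length : ∀ τ s → orderIso τ s ≡ true → length τ ≡ length s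
orderIso-length τ s iso with length τ ==ℕ length s in eq
... | true = ==ℕ-true eq

compat-above : ∀ a b c d → d < c → compat (a , c) (b , d) ≡ (b <ᵇ a)
compat-above a b c d d<c rewrite <ᵇ-false d<c | <ᵇ-true d<c with a <ᵇ b in a<ᵇb | b <ᵇ a in b<ᵇa
... | true  | true  = ⊥-elim (<-asym (<ᵇ≡true⇒< {a} {b} a<ᵇb) (<ᵇ≡true⇒< {b} {a} b<ᵇa))
... | true  | false = refl
... | false | true  = refl
... | false | false = refl

compat-below : ∀ a b c d → c < d → compat (a , c) (b , d) ≡ (a <ᵇ b)
compat-below a b c d c<d rewrite <ᵇ-false c<d | <ᵇ-true c<d with a <ᵇ b in a<ᵇb | b <ᵇ a in b<ᵇa
... | true  | true  = ⊥-elim (<-asym (<ᵇ≡true⇒< {a} {b} a<ᵇb) (<ᵇ≡true⇒< {b} {a} b<ᵇa))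
... | true  | false = refl
... | false | true  = refl
... | false | false = refl

Above : List ℕ → List ℕ → Set
Above s t = All (λ c → All (_< c) t) s

crossCompat-above₁ : ∀ a c (τ t : List ℕ) → length τ ≡ length t → All (_< c) t →
  and (map (compat (a , c)) (zip τ t)) ≡ allBelow τ a
crossCompat-above₁ a c []      []      _     _           = refl
crossCompat-above₁ a c (b ∷ τ) (d ∷ t) |τ|≡|t| (d<c ∷ t<c) =
  cong₂ _∧_ (compat-above a b c d d<c) (crossCompat-above₁ a c τ t (suc-injective |τ|≡|t|) t<c)

crossCompat-above : ∀ (τ₁ s τ₂ t : List ℕ) → length τ₁ ≡ length s → length τ₂ ≡ length t → Above s t →
  crossCompat (zip τ₁ s) (zip τ₂ t) ≡ allAbove τ₁ τ₂
crossCompat-above []       []      τ₂ t _        _        _            = refl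
crossCompat-above (a ∷ τ₁) (c ∷ s) τ₂ t |τ₁|≡|s| |τ₂|≡|t| (t<c ∷ s>t) =
  cong₂ _∧_ (crossCompat-above₁ a c τ₂ t |τ₂|≡|t| t<c) (crossCompat-above τ₁ s τ₂ t (suc-injective |τ₁|≡|s|) |τ₂|≡|t| s>t)

crossCompat-max : ∀ (τ s : List ℕ) b N → length τ ≡ length s → All (_< N) s →
  crossCompat (zip τ s) ((b , N) ∷ []) ≡ allAbove (b ∷ []) τ
crossCompat-max []      []      b N _       _            = refl
crossCompat-max (a ∷ τ) (c ∷ s) b N |τ|≡|s| (c<N ∷ s<N) =
  trans (cong₂ _∧_ (trans (∧-identityʳ _) (compat-below a b c N c<N)) (crossCompat-max τ s b N (suc-injective |τ|≡|s|) s<N))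
        (sym (∧-assoc (a <ᵇ b) (allBelow τ b) true))

crossCompat-[]ʳ : ∀ ps → crossCompat ps [] ≡ true
crossCompat-[]ʳ []       = refl
crossCompat-[]ʳ (p ∷ ps) = crossCompat-[]ʳ ps

<ᵇ-+ʳ : ∀ a b c → ((a + c) <ᵇ (b + c)) ≡ (a <ᵇ b)
<ᵇ-+ʳ a b c rewrite +-comm a c | +-comm b c = <ᵇ-+ˡ c
  where
  <ᵇ-+ˡ : ∀ c → ((c + a) <ᵇ (c + b)) ≡ (a <ᵇ b)
  <ᵇ-+ˡ zero    = refl
  <ᵇ-+ˡ (suc c) = <ᵇ-+ˡ c

and-map-map : ∀ (c₁ c₂ : ℕ × ℕ → Bool) (g : ℕ × ℕ → ℕ × ℕ) ps →
  (∀ q → c₁ (g q) ≡ c₂ q) → and (map c₁ (map g ps)) ≡ and (map c₂ ps)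
and-map-map c₁ c₂ g []       c₁∘g≡c₂ = refl
and-map-map c₁ c₂ g (q ∷ ps) c₁∘g≡c₂ = cong₂ _∧_ (c₁∘g≡c₂ q) (and-map-map c₁ c₂ g ps c₁∘g≡c₂)

pairsOK-map : (g : ℕ × ℕ → ℕ × ℕ) → (∀ p q → compat (g p) (g q) ≡ compat p q) → ∀ ps → pairsOK (map g ps) ≡ pairsOK ps
pairsOK-map g g-compat []       = refl
pairsOK-map g g-compat (p ∷ ps) =
  cong₂ _∧_ (and-map-map (compat (g p)) (compat p) g ps (g-compat p)) (pairsOK-map g g-compat ps)

zip-mapˡ : ∀ (f : ℕ → ℕ) (σ α : List ℕ) → zip (map f σ) α ≡ map (λ (a , x) → (f a , x)) (zip σ α)
zip-mapˡ f []      α       = refl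
zip-mapˡ f (a ∷ σ) []      = refl
zip-mapˡ f (a ∷ σ) (x ∷ α) = cong ((f a , x) ∷_) (zip-mapˡ f σ α)

zip-mapʳ : ∀ (f : ℕ → ℕ) (σ α : List ℕ) → zip σ (map f α) ≡ map (λ (a , x) → (a , f x)) (zip σ α)
zip-mapʳ f []      α       = refl
zip-mapʳ f (a ∷ σ) []      = refl
zip-mapʳ f (a ∷ σ) (x ∷ α) = cong ((a , f x) ∷_) (zip-mapʳ f σ α)

orderIso-shiftˡ : ∀ c σ α → orderIso (shift c σ) α ≡ orderIso σ α
orderIso-shiftˡ c σ α = cong₂ _∧_ (cong (_==ℕ length α) (length-map (_+ c) σ))
  (trans (cong pairsOK (zip-mapˡ (_+ c) σ α)) (pairsOK-map _ (λ (a , x) (b , y) → cong₂ _∧_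
     (cong (λ z → not (z xor (x <ᵇ y))) (<ᵇ-+ʳ a b c))
     (cong (λ z → not (z xor (y <ᵇ x))) (<ᵇ-+ʳ b a c))) (zip σ α)))

orderIso-shiftʳ : ∀ c σ α → orderIso σ (shift c α) ≡ orderIso σ α
orderIso-shiftʳ c σ α = cong₂ _∧_ (cong (length σ ==ℕ_) (length-map (_+ c) α))
  (trans (cong pairsOK (zip-mapʳ (_+ c) σ α)) (pairsOK-map _ (λ (a , x) (b , y) → cong₂ _∧_
     (cong (λ z → not ((a <ᵇ b) xor z)) (<ᵇ-+ʳ x y c))
     (cong (λ z → not ((b <ᵇ a) xor z)) (<ᵇ-+ʳ y x c))) (zip σ α)))

occ-shiftˡ : ∀ c σ α → occ (shift c σ) α ≡ occ σ α
occ-shiftˡ c σ α =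
  trans (occ≡Σ (shift c σ) α)
        (trans (Σl-cong (subseqs α) (λ s → cong ind (orderIso-shiftˡ c σ s))) (sym (occ≡Σ σ α)))

occ-shiftʳ : ∀ c σ α → occ σ (shift c α) ≡ occ σ α
occ-shiftʳ c σ α =
  trans (occ≡Σ σ (shift c α))
        (trans (Σ-subseqs-map (_+ c) α _)
               (trans (Σl-cong (subseqs α) (λ s → cong ind (orderIso-shiftʳ c σ s))) (sym (occ≡Σ σ α))))

allBelow-++ : ∀ V W a → allBelow (V ++ W) a ≡ (allBelow V a ∧ allBelow W a)
allBelow-++ []      W a = refl
allBelow-++ (b ∷ V) W a = trans (cong ((b <ᵇ a) ∧_) (allBelow-++ V W a)) (sym (∧-assoc (b <ᵇ a) _ _))

allAbove-++ˡ : ∀ X Y W → allAbove (X ++ Y) W ≡ (allAbove X W ∧ allAbove Y W)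
allAbove-++ˡ []      Y W = refl
allAbove-++ˡ (a ∷ X) Y W = trans (cong (allBelow W a ∧_) (allAbove-++ˡ X Y W)) (sym (∧-assoc (allBelow W a) _ _))

allAbove-++ʳ : ∀ X V W → allAbove X (V ++ W) ≡ (allAbove X V ∧ allAbove X W)
allAbove-++ʳ []      V W = refl
allAbove-++ʳ (a ∷ X) V W =
  trans (cong₂ _∧_ (allBelow-++ V W a) (allAbove-++ʳ X V W))
        (∧-interchange (allBelow V a) (allBelow W a) (allAbove X V) (allAbove X W))

∧≡true : ∀ {a b} → (a ∧ b) ≡ true → (a ≡ true) × (b ≡ true)
∧≡true {true} {true} _ = refl , refl

-- Occurrences of concatenated blocks in xs ++ ys

Inseparable : List ℕ → Set
Inseparable B = ∀ B₁ B₂ → B₁ ++ B₂ ≡ B → 0 < length B₁ → 0 < length B₂ → allAbove B₁ B₂ ≡ false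

Block : List ℕ → Set
Block B = (0 < length B) × Inseparable B

Descending : List (List ℕ) → Set
Descending []       = ⊤
Descending (B ∷ bs) = (allAbove B (concat bs) ≡ true) × Descending bs

-- The possible ways an occurrence of Z ++ concat bs in s ++ t can cut the pattern.
blockSplit : List ℕ → List (List ℕ) → List ℕ → List ℕ → ℕ
blockSplit Z []       s t = ind (orderIso Z s) * ind (orderIso [] t)
blockSplit Z (B ∷ bs) s t = ind (orderIso Z s) * ind (orderIso (concat (B ∷ bs)) t) + blockSplit (Z ++ B) bs s t

splitAt-length : ∀ k (B : List ℕ) → k ≤ length B →
  Σ (List ℕ) (λ B₁ → Σ (List ℕ) (λ B₂ → (B₁ ++ B₂ ≡ B) × (length B₁ ≡ k)))
splitAt-length zero    B       _         = [] , B , refl , refl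
splitAt-length (suc k) (b ∷ B) (s≤s k≤B) with splitAt-length k B k≤B
... | B₁ , B₂ , B₁++B₂≡B , |B₁|≡k = b ∷ B₁ , B₂ , cong (b ∷_) B₁++B₂≡B , cong suc |B₁|≡k

orderIso-short : ∀ Z s → length s < length Z → orderIso Z s ≡ false
orderIso-short Z s |s|<|Z| = orderIso-length-≢ Z s (λ eq → <-irrefl (sym eq) |s|<|Z|)

ind-orderIso-≢ : ∀ Z s → length Z ≢ length s → ind (orderIso Z s) ≡ 0
ind-orderIso-≢ Z s |Z|≢|s| rewrite orderIso-length-≢ Z s |Z|≢|s| = refl

blockSplit-short : ∀ Z bs s t → length s < length Z → blockSplit Z bs s t ≡ 0
blockSplit-short Z []       s t |s|<|Z| rewrite orderIso-short Z s |s|<|Z| = refl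
blockSplit-short Z (B ∷ bs) s t |s|<|Z| rewrite orderIso-short Z s |s|<|Z| =
  blockSplit-short (Z ++ B) bs s t (<-≤-trans |s|<|Z| (subst (length Z ≤_) (sym (length-++ Z)) (m≤m+n (length Z) (length B))))

ind-∧-implied : ∀ a b c → (b ≡ true → c ≡ true) → ind ((a ∧ b) ∧ c) ≡ ind a * ind b
ind-∧-implied a false c _   = trans (cong (λ z → ind (z ∧ c)) (∧-zeroʳ a)) (sym (*-zeroʳ (ind a)))
ind-∧-implied a true  c b⇒c rewrite b⇒c refl | ∧-identityʳ a | ∧-identityʳ a = sym (*-identityʳ (ind a))

ind-∧-excluded : ∀ a b c → (b ≡ true → c ≡ false) → ind ((a ∧ b) ∧ c) ≡ 0
ind-∧-excluded a false c _    = cong (λ z → ind (z ∧ c)) (∧-zeroʳ a)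
ind-∧-excluded a true  c b⇒¬c rewrite b⇒¬c refl = cong ind (∧-zeroʳ (a ∧ true))

module _ (s t : List ℕ) (s>t : Above s t) where

  orderIso-blocks-boundary : ∀ Z rest → length Z ≡ length s → allAbove Z rest ≡ true →
    ind (orderIso (Z ++ rest) (s ++ t)) ≡ ind (orderIso Z s) * ind (orderIso rest t)
  orderIso-blocks-boundary Z rest |Z|≡|s| Z>rest =
    trans (cong ind (orderIso-++ Z s {rest} {t} |Z|≡|s|))
          (ind-∧-implied (orderIso Z s) (orderIso rest t) _ (λ iso →
             trans (crossCompat-above Z s rest t |Z|≡|s| (orderIso-length rest t iso) s>t) Z>rest))

  -- A cut inside an inseparable block B = B₁ ++ B₂ would need B₁ above B₂.
  orderIso-blocks-inside : ∀ Z B rest → Inseparable B → length Z < length s → length s < length (Z ++ B) →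
    ind (orderIso (Z ++ (B ++ rest)) (s ++ t)) ≡ 0
  orderIso-blocks-inside Z B rest B-insep |Z|<|s| |s|<|ZB| =
    trans (cong (λ z → ind (orderIso z (s ++ t))) Z++B≡)
          (trans (cong ind (orderIso-++ (Z ++ B₁) s {B₂ ++ rest} {t} |ZB₁|≡|s|))
                 (ind-∧-excluded (orderIso (Z ++ B₁) s) (orderIso (B₂ ++ rest) t) _ cut-fails))
    where
    k = length s ∸ length Z
    |B|≡ : length (Z ++ B) ∸ length Z ≡ length B
    |B|≡ = trans (cong (_∸ length Z) (length-++ Z)) (m+n∸m≡n (length Z) (length B))
    k<|B| : k < length B
    k<|B| = subst (k <_) |B|≡ (∸-monoˡ-< |s|<|ZB| (<⇒≤ |Z|<|s|))
    split = splitAt-length k B (<⇒≤ k<|B|)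
    B₁ = proj₁ split
    B₂ = proj₁ (proj₂ split)
    B₁++B₂≡B : B₁ ++ B₂ ≡ B
    B₁++B₂≡B = proj₁ (proj₂ (proj₂ split))
    |B₁|≡k : length B₁ ≡ k
    |B₁|≡k = proj₂ (proj₂ (proj₂ split))
    Z++B≡ : Z ++ (B ++ rest) ≡ (Z ++ B₁) ++ (B₂ ++ rest)
    Z++B≡ = trans (cong (λ z → Z ++ (z ++ rest)) (sym B₁++B₂≡B))
                  (trans (cong (Z ++_) (++-assoc B₁ B₂ rest)) (sym (++-assoc Z B₁ (B₂ ++ rest))))
    |ZB₁|≡|s| : length (Z ++ B₁) ≡ length s
    |ZB₁|≡|s| = trans (length-++ Z) (trans (cong (length Z +_) |B₁|≡k) (m+[n∸m]≡n (<⇒≤ |Z|<|s|)))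
    B₁≢[] : 0 < length B₁
    B₁≢[] = subst (0 <_) (sym |B₁|≡k) (m<n⇒0<n∸m |Z|<|s|)
    B₂≢[] : 0 < length B₂
    B₂≢[] = +-cancelˡ-< (length B₁) 0 (length B₂)
      (subst₂ _<_ (sym (+-identityʳ (length B₁))) (trans (cong length (sym B₁++B₂≡B)) (length-++ B₁))
              (subst (_< length B) (sym |B₁|≡k) k<|B|))
    cut-fails : orderIso (B₂ ++ rest) t ≡ true → crossCompat (zip (Z ++ B₁) s) (zip (B₂ ++ rest) t) ≡ false
    cut-fails iso = begin
      crossCompat (zip (Z ++ B₁) s) (zip (B₂ ++ rest) t)
        ≡⟨ crossCompat-above (Z ++ B₁) s (B₂ ++ rest) t |ZB₁|≡|s| (orderIso-length (B₂ ++ rest) t iso) s>t ⟩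
      allAbove (Z ++ B₁) (B₂ ++ rest)
        ≡⟨ allAbove-++ˡ Z B₁ (B₂ ++ rest) ⟩
      allAbove Z (B₂ ++ rest) ∧ allAbove B₁ (B₂ ++ rest)
        ≡⟨ cong (allAbove Z (B₂ ++ rest) ∧_) (allAbove-++ʳ B₁ B₂ rest) ⟩
      allAbove Z (B₂ ++ rest) ∧ (allAbove B₁ B₂ ∧ allAbove B₁ rest)
        ≡⟨ cong (λ b → allAbove Z (B₂ ++ rest) ∧ (b ∧ allAbove B₁ rest)) (B-insep B₁ B₂ B₁++B₂≡B B₁≢[] B₂≢[]) ⟩
      allAbove Z (B₂ ++ rest) ∧ false
        ≡⟨ ∧-zeroʳ _ ⟩
      false ∎
      where open ≡-Reasoning

  -- Z is the part of the pattern already matched inside s.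
  orderIso-blocks : ∀ bs Z → length Z ≤ length s → allAbove Z (concat bs) ≡ true → Descending bs → All Block bs →
    ind (orderIso (Z ++ concat bs) (s ++ t)) ≡ blockSplit Z bs s t
  orderIso-blocks [] Z |Z|≤|s| _ _ _ with m≤n⇒m<n∨m≡n |Z|≤|s|
  ... | inj₂ |Z|≡|s| =
    trans (cong ind (orderIso-++ Z s {[]} {t} |Z|≡|s|))
          (trans (cong (λ b → ind ((orderIso Z s ∧ orderIso [] t) ∧ b)) (crossCompat-[]ʳ (zip Z s)))
                 (trans (cong ind (∧-identityʳ _)) (ind-∧ (orderIso Z s) (orderIso [] t))))
  ... | inj₁ |Z|<|s| =
    trans (ind-orderIso-≢ (Z ++ []) (s ++ t) (λ eq → <-irrefl (trans (sym (cong length (++-identityʳ Z))) eq) |Z|<|st|))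
          (sym (cong (_* ind (orderIso [] t)) (ind-orderIso-≢ Z s (λ eq → <-irrefl eq |Z|<|s|))))
    where
    |Z|<|st| : length Z < length (s ++ t)
    |Z|<|st| = <-≤-trans |Z|<|s| (subst (length s ≤_) (sym (length-++ s)) (m≤m+n (length s) (length t)))
  orderIso-blocks (B ∷ bs) Z |Z|≤|s| Z>B++bs (B>bs , bs-desc) ((B≢[] , B-insep) ∷ bs-blocks) with m≤n⇒m<n∨m≡n |Z|≤|s|
  ... | inj₂ |Z|≡|s| =
    trans (orderIso-blocks-boundary Z (B ++ concat bs) |Z|≡|s| Z>B++bs)
          (sym (trans (cong (ind (orderIso Z s) * ind (orderIso (B ++ concat bs) t) +_)
                            (blockSplit-short (Z ++ B) bs s t |s|<|ZB|))
                      (+-identityʳ _)))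
    where
    |s|<|ZB| : length s < length (Z ++ B)
    |s|<|ZB| = subst (_< length (Z ++ B)) |Z|≡|s| (subst (length Z <_) (sym (length-++ Z)) (m<m+n (length Z) B≢[]))
  ... | inj₁ |Z|<|s| with length s <? length (Z ++ B)
  ...   | yes |s|<|ZB| =
    trans (orderIso-blocks-inside Z B (concat bs) B-insep |Z|<|s| |s|<|ZB|)
          (sym (cong₂ _+_ (cong (_* ind (orderIso (B ++ concat bs) t)) (ind-orderIso-≢ Z s (λ eq → <-irrefl eq |Z|<|s|)))
                          (blockSplit-short (Z ++ B) bs s t |s|<|ZB|)))
  ...   | no |s|≮|ZB| =
    trans (cong (λ z → ind (orderIso z (s ++ t))) (sym (++-assoc Z B (concat bs))))
    (trans (orderIso-blocks bs (Z ++ B) (≮⇒≥ |s|≮|ZB|) ZB>bs bs-desc bs-blocks)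
           (sym (cong (_+ blockSplit (Z ++ B) bs s t)
                      (cong (_* ind (orderIso (B ++ concat bs) t)) (ind-orderIso-≢ Z s (λ eq → <-irrefl eq |Z|<|s|))))))
    where
    ZB>bs : allAbove (Z ++ B) (concat bs) ≡ true
    ZB>bs = trans (allAbove-++ˡ Z B (concat bs))
                  (cong₂ _∧_ (proj₂ (∧≡true (trans (sym (allAbove-++ʳ Z B (concat bs))) Z>B++bs))) B>bs)

occBlockSplit : List ℕ → List (List ℕ) → List ℕ → List ℕ → ℕ
occBlockSplit Z []       xs ys = occ Z xs * occ [] ys
occBlockSplit Z (B ∷ bs) xs ys = occ Z xs * occ (concat (B ∷ bs)) ys + occBlockSplit (Z ++ B) bs xs ys

Σ-blockSplit : ∀ bs Z xs ys →
  Σl (subseqs xs) (λ s → Σl (subseqs ys) (λ t → blockSplit Z bs s t)) ≡ occBlockSplit Z bs xs ys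
Σ-blockSplit [] Z xs ys =
  trans (Σl-product (subseqs xs) (subseqs ys) (λ s → ind (orderIso Z s)) (λ t → ind (orderIso [] t)))
        (sym (cong₂ _*_ (occ≡Σ Z xs) (occ≡Σ [] ys)))
Σ-blockSplit (B ∷ bs) Z xs ys =
  trans (ΣΣ-distrib-+ (subseqs xs) (subseqs ys) _ _)
  (cong₂ _+_ (trans (Σl-product (subseqs xs) (subseqs ys) (λ s → ind (orderIso Z s)) (λ t → ind (orderIso (concat (B ∷ bs)) t)))
                    (sym (cong₂ _*_ (occ≡Σ Z xs) (occ≡Σ (concat (B ∷ bs)) ys))))
             (Σ-blockSplit bs (Z ++ B) xs ys))

Above-∷ʳ : ∀ {y t} s → All (y <_) s → Above s t → Above s (y ∷ t)
Above-∷ʳ []      []          []          = []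
Above-∷ʳ (c ∷ s) (y<c ∷ y<s) (t<c ∷ s>t) = (y<c ∷ t<c) ∷ Above-∷ʳ s y<s s>t

Above-tailʳ : ∀ {y t} s → Above s (y ∷ t) → Above s t
Above-tailʳ []      []                = []
Above-tailʳ (c ∷ s) ((_ ∷ t<c) ∷ s>t) = t<c ∷ Above-tailʳ s s>t

Above-headʳ : ∀ {y t} s → Above s (y ∷ t) → All (y <_) s
Above-headʳ []      []                = []
Above-headʳ (c ∷ s) ((y<c ∷ _) ∷ s>t) = y<c ∷ Above-headʳ s s>t

Above-[]ʳ : ∀ s → Above s []
Above-[]ʳ []      = []
Above-[]ʳ (c ∷ s) = [] ∷ Above-[]ʳ s

Above-subseqs : ∀ s ys → Above s ys → All (Above s) (subseqs ys)
Above-subseqs s []       _    = Above-[]ʳ s ∷ []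
Above-subseqs s (y ∷ ys) s>ys =
  AllP.++⁺ (AllP.map⁺ (All.map (Above-∷ʳ s (Above-headʳ s s>ys)) s>subseqs)) s>subseqs
  where
  s>subseqs = Above-subseqs s ys (Above-tailʳ s s>ys)

-- With xs above ys, an occurrence of a descending sequence of inseparable blocks in xs ++ ys
-- is cut between two blocks.
occ-blocks-++ : ∀ bs xs ys → Above xs ys → Descending bs → All Block bs →
  occ (concat bs) (xs ++ ys) ≡ occBlockSplit [] bs xs ys
occ-blocks-++ bs xs ys xs>ys bs-desc bs-blocks =
  trans (occ≡Σ (concat bs) (xs ++ ys))
  (trans (Σ-subseqs-++ xs ys _)
  (trans (Σl-cong-All (subseqs-All xs>ys) (λ s s>ys → Σl-cong-All (Above-subseqs s ys s>ys) (λ t s>t →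
            orderIso-blocks s t s>t bs [] z≤n refl bs-desc bs-blocks)))
         (Σ-blockSplit bs [] xs ys)))

Σ-subseqs-pos : ∀ {s w} → s ⊆ w → (f : List ℕ → ℕ) → 1 ≤ f s → 1 ≤ Σl (subseqs w) f
Σ-subseqs-pos []                       f fs>0 = ≤-trans fs>0 (m≤m+n _ 0)
Σ-subseqs-pos {w = x ∷ w} (x ∷ʳ s⊆w)   f fs>0 =
  ≤-trans (Σ-subseqs-pos s⊆w f fs>0) (≤-trans (m≤n+m _ _) (≤-reflexive (sym (Σ-subseqs-∷ x w f))))
Σ-subseqs-pos {w = x ∷ w} (refl ∷ s⊆w) f fs>0 =
  ≤-trans (Σ-subseqs-pos s⊆w (f ∘ (x ∷_)) fs>0) (≤-trans (m≤m+n _ _) (≤-reflexive (sym (Σ-subseqs-∷ x w f))))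

Σ-subseqs-witness : ∀ w (f : List ℕ → ℕ) → 1 ≤ Σl (subseqs w) f → Σ (List ℕ) (λ s → (s ⊆ w) × (1 ≤ f s))
Σ-subseqs-witness []      f Σ>0 = [] , [] , subst (1 ≤_) (+-identityʳ _) Σ>0
Σ-subseqs-witness (x ∷ w) f Σ>0 = pick (subst (1 ≤_) (Σ-subseqs-∷ x w f) Σ>0)
  where
  pick : 1 ≤ Σl (subseqs w) (f ∘ (x ∷_)) + Σl (subseqs w) f → Σ (List ℕ) (λ s → (s ⊆ x ∷ w) × (1 ≤ f s))
  pick Σ′>0 with Σl (subseqs w) (f ∘ (x ∷_)) in eq
  ... | suc _ = let (s , s⊆w , fs>0) = Σ-subseqs-witness w (f ∘ (x ∷_)) (subst (1 ≤_) (sym eq) (s≤s z≤n))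
                in x ∷ s , refl ∷ s⊆w , fs>0
  ... | zero  = let (s , s⊆w , fs>0) = Σ-subseqs-witness w f Σ′>0 in s , x ∷ʳ s⊆w , fs>0

Σ-subseqs-two : ∀ {s₁ s₂ w} → s₁ ⊆ w → s₂ ⊆ w → s₁ ≢ s₂ → (f : List ℕ → ℕ) → 1 ≤ f s₁ → 1 ≤ f s₂ →
  2 ≤ Σl (subseqs w) f
Σ-subseqs-two [] [] s₁≢s₂ f _ _ = ⊥-elim (s₁≢s₂ refl)
Σ-subseqs-two {w = x ∷ w} (x ∷ʳ p₁) (x ∷ʳ p₂) s₁≢s₂ f f₁ f₂ =
  ≤-trans (Σ-subseqs-two p₁ p₂ s₁≢s₂ f f₁ f₂) (≤-trans (m≤n+m _ _) (≤-reflexive (sym (Σ-subseqs-∷ x w f))))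
Σ-subseqs-two {w = x ∷ w} (refl ∷ p₁) (refl ∷ p₂) s₁≢s₂ f f₁ f₂ =
  ≤-trans (Σ-subseqs-two p₁ p₂ (s₁≢s₂ ∘ cong (x ∷_)) (f ∘ (x ∷_)) f₁ f₂)
          (≤-trans (m≤m+n _ _) (≤-reflexive (sym (Σ-subseqs-∷ x w f))))
Σ-subseqs-two {w = x ∷ w} (refl ∷ p₁) (x ∷ʳ p₂) _ f f₁ f₂ =
  ≤-trans (+-mono-≤ (Σ-subseqs-pos p₁ (f ∘ (x ∷_)) f₁) (Σ-subseqs-pos p₂ f f₂)) (≤-reflexive (sym (Σ-subseqs-∷ x w f)))
Σ-subseqs-two {w = x ∷ w} (x ∷ʳ p₁) (refl ∷ p₂) _ f f₁ f₂ =
  ≤-trans (+-mono-≤ (Σ-subseqs-pos p₂ (f ∘ (x ∷_)) f₂) (Σ-subseqs-pos p₁ f f₁)) (≤-reflexive (sym (Σ-subseqs-∷ x w f)))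

ind-true : ∀ {b} → b ≡ true → 1 ≤ ind b
ind-true refl = s≤s z≤n

occ-pos : ∀ {s w} τ → s ⊆ w → orderIso τ s ≡ true → 1 ≤ occ τ w
occ-pos {w = w} τ s⊆w iso = subst (1 ≤_) (sym (occ≡Σ τ w)) (Σ-subseqs-pos s⊆w (λ s → ind (orderIso τ s)) (ind-true iso))

occ-witness : ∀ τ w → 1 ≤ occ τ w → Σ (List ℕ) (λ s → (s ⊆ w) × (orderIso τ s ≡ true))
occ-witness τ w occ>0 with Σ-subseqs-witness w (λ s → ind (orderIso τ s)) (subst (1 ≤_) (occ≡Σ τ w) occ>0)
... | s , s⊆w , ind>0 = s , s⊆w , ind≥1⇒true (orderIso τ s) ind>0
  where
  ind≥1⇒true : ∀ b → 1 ≤ ind b → b ≡ true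
  ind≥1⇒true true _ = refl

occ-two : ∀ {s₁ s₂ w} τ → s₁ ⊆ w → s₂ ⊆ w → s₁ ≢ s₂ → orderIso τ s₁ ≡ true → orderIso τ s₂ ≡ true → 2 ≤ occ τ w
occ-two {w = w} τ p₁ p₂ s₁≢s₂ iso₁ iso₂ =
  subst (2 ≤_) (sym (occ≡Σ τ w)) (Σ-subseqs-two p₁ p₂ s₁≢s₂ (λ s → ind (orderIso τ s)) (ind-true iso₁) (ind-true iso₂))

occ-[] : ∀ α → occ [] α ≡ 1
occ-[] α = trans (occ≡Σ [] α) (Σ-subseqs-[] α)
  where
  Σ-subseqs-[] : ∀ α → Σl (subseqs α) (λ s → ind (orderIso [] s)) ≡ 1
  Σ-subseqs-[] []      = refl
  Σ-subseqs-[] (x ∷ α) =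
    trans (Σ-subseqs-∷ x α _) (trans (cong (_+ Σl (subseqs α) (λ s → ind (orderIso [] s))) (Σl-zero (subseqs α) _ (λ s → refl)))
                                     (Σ-subseqs-[] α))

orderIso-++-split : ∀ σ₁ σ₂ s → orderIso (σ₁ ++ σ₂) s ≡ true →
  Σ (List ℕ) (λ s₁ → Σ (List ℕ) (λ s₂ → (s₁ ++ s₂ ≡ s) × (orderIso σ₁ s₁ ≡ true) × (orderIso σ₂ s₂ ≡ true)))
orderIso-++-split σ₁ σ₂ s iso with splitAt-length (length σ₁) s |σ₁|≤|s|
  where
  |σ₁|≤|s| : length σ₁ ≤ length s
  |σ₁|≤|s| = subst (length σ₁ ≤_) (trans (sym (length-++ σ₁)) (orderIso-length (σ₁ ++ σ₂) s iso)) (m≤m+n (length σ₁) (length σ₂))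
... | s₁ , s₂ , s₁++s₂≡s , |s₁|≡|σ₁| = s₁ , s₂ , s₁++s₂≡s , proj₁ both , proj₂ both
  where
  both = ∧≡true (proj₁ (∧≡true (trans (sym (orderIso-++ σ₁ s₁ {σ₂} {s₂} (sym |s₁|≡|σ₁|)))
                                       (trans (cong (orderIso (σ₁ ++ σ₂)) s₁++s₂≡s) iso))))

occ-prefix : ∀ σ₁ σ₂ w → 1 ≤ occ (σ₁ ++ σ₂) w → 1 ≤ occ σ₁ w
occ-prefix σ₁ σ₂ w occ>0 with occ-witness (σ₁ ++ σ₂) w occ>0
... | s , s⊆w , iso with orderIso-++-split σ₁ σ₂ s iso
...   | s₁ , s₂ , refl , iso₁ , _ = occ-pos σ₁ (⊆-trans (++⁺ʳ s₂ ⊆-refl) s⊆w) iso₁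

occ-suffix : ∀ σ₁ σ₂ w → 1 ≤ occ (σ₁ ++ σ₂) w → 1 ≤ occ σ₂ w
occ-suffix σ₁ σ₂ w occ>0 with occ-witness (σ₁ ++ σ₂) w occ>0
... | s , s⊆w , iso with orderIso-++-split σ₁ σ₂ s iso
...   | s₁ , s₂ , refl , _ , iso₂ = occ-pos σ₂ (⊆-trans (++⁺ˡ s₁ ⊆-refl) s⊆w) iso₂

orderIso-∷ʳ-max : ∀ σ c s N → All (_< N) s →
  ind (orderIso (σ ++ c ∷ []) (s ++ N ∷ [])) ≡ ind (allAbove (c ∷ []) σ) * ind (orderIso σ s)
orderIso-∷ʳ-max σ c s N s<N with length σ ≟ length s
... | yes |σ|≡|s| = begin
  ind (orderIso (σ ++ c ∷ []) (s ++ N ∷ []))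
    ≡⟨ cong ind (orderIso-++ σ s {c ∷ []} {N ∷ []} |σ|≡|s|) ⟩
  ind ((orderIso σ s ∧ true) ∧ crossCompat (zip σ s) ((c , N) ∷ []))
    ≡⟨ cong₂ (λ a b → ind (a ∧ b)) (∧-identityʳ (orderIso σ s)) (crossCompat-max σ s c N |σ|≡|s| s<N) ⟩
  ind (orderIso σ s ∧ allAbove (c ∷ []) σ)
    ≡⟨ trans (ind-∧ (orderIso σ s) _) (*-comm (ind (orderIso σ s)) _) ⟩
  ind (allAbove (c ∷ []) σ) * ind (orderIso σ s) ∎
  where open ≡-Reasoning
... | no |σ|≢|s| =
  trans (ind-orderIso-≢ (σ ++ c ∷ []) (s ++ N ∷ []) |σc|≢|sN|)
        (sym (trans (cong (ind (allAbove (c ∷ []) σ) *_) (ind-orderIso-≢ σ s |σ|≢|s|)) (*-zeroʳ (ind (allAbove (c ∷ []) σ)))))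
  where
  |σc|≢|sN| : length (σ ++ c ∷ []) ≢ length (s ++ N ∷ [])
  |σc|≢|sN| eq = |σ|≢|s| (+-cancelʳ-≡ 1 (length σ) (length s) (trans (sym (length-++ σ)) (trans eq (length-++ s))))

occ-∷ʳ-max : ∀ σ c w N → All (_< N) w →
  occ (σ ++ c ∷ []) (w ++ N ∷ []) ≡ occ (σ ++ c ∷ []) w + ind (allAbove (c ∷ []) σ) * occ σ w
occ-∷ʳ-max σ c w N w<N = begin
  occ σc (w ++ N ∷ [])
    ≡⟨ occ≡Σ σc (w ++ N ∷ []) ⟩
  Σl (subseqs (w ++ N ∷ [])) (λ s → ind (orderIso σc s))
    ≡⟨ Σ-subseqs-++ w (N ∷ []) _ ⟩
  Σl (subseqs w) (λ s → ind (orderIso σc (s ++ N ∷ [])) + (ind (orderIso σc (s ++ [])) + 0))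
    ≡⟨ Σl-cong-All (subseqs-All w<N) per-subsequence ⟩
  Σl (subseqs w) (λ s → ind (orderIso σc s) + top * ind (orderIso σ s))
    ≡⟨ Σl-distrib-+ (subseqs w) _ _ ⟩
  Σl (subseqs w) (λ s → ind (orderIso σc s)) + Σl (subseqs w) (λ s → top * ind (orderIso σ s))
    ≡⟨ cong₂ _+_ (sym (occ≡Σ σc w)) (trans (Σl-*ˡ (subseqs w) top _) (cong (top *_) (sym (occ≡Σ σ w)))) ⟩
  occ σc w + top * occ σ w ∎
  where
  open ≡-Reasoning
  σc = σ ++ c ∷ []
  top = ind (allAbove (c ∷ []) σ)
  per-subsequence : ∀ s → All (_< N) s →
    ind (orderIso σc (s ++ N ∷ [])) + (ind (orderIso σc (s ++ [])) + 0) ≡ ind (orderIso σc s) + top * ind (orderIso σ s)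
  per-subsequence s s<N =
    trans (cong₂ _+_ (orderIso-∷ʳ-max σ c s N s<N) (trans (+-identityʳ _) (cong (λ z → ind (orderIso σc z)) (++-identityʳ s))))
          (+-comm (top * ind (orderIso σ s)) (ind (orderIso σc s)))

-- 132-avoiders split at their maximum

insertAll-unique : ∀ x β → Unique β → All (_< x) β → All Unique (insertAll x β)
insertAll-unique x []       []           []           = ([] ∷ []) ∷ []
insertAll-unique x (y ∷ ys) (y∉ys ∷ uys) (y<x ∷ ys<x) =
  (((λ x≡y → <-irrefl (sym x≡y) y<x) ∷ All.map (λ z<x x≡z → <-irrefl (sym x≡z) z<x) ys<x) ∷ y∉ys ∷ uys)
  ∷ AllP.map⁺ (All.zipWith (λ (y∉w , uw) → y∉w ∷ uw)
                (insertAll-All ys (λ y≡x → <-irrefl y≡x y<x) y∉ys , insertAll-unique x ys uys ys<x))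

perms-unique : ∀ n → All Unique (perms n)
perms-unique zero    = [] ∷ []
perms-unique (suc n) = AllP.concat⁺ (AllP.map⁺ (All.zipWith (λ {β} (uβ , bβ) →
  insertAll-unique (suc n) β uβ (All.map (λ (_ , x≤n) → s≤s x≤n) bβ)) (perms-unique n , perms-bounded n)))

allBelow⇒All : ∀ v a → allBelow v a ≡ true → All (_< a) v
allBelow⇒All []      a _  = []
allBelow⇒All (b ∷ v) a eq = <ᵇ≡true⇒< (proj₁ (∧≡true eq)) ∷ allBelow⇒All v a (proj₂ (∧≡true {b <ᵇ a} eq))

allAbove⇒Above : ∀ u v → allAbove u v ≡ true → Above u v
allAbove⇒Above []      v _  = []
allAbove⇒Above (a ∷ u) v eq = allBelow⇒All v a (proj₁ (∧≡true eq)) ∷ allAbove⇒Above u v (proj₂ (∧≡true {allBelow v a} eq))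

allBelow-false : ∀ v a → allBelow v a ≡ false → Σ ℕ (λ b → ([ b ] ⊆ v) × ((b <ᵇ a) ≡ false))
allBelow-false (b ∷ v) a eq with b <ᵇ a in b<ᵇa
... | false = b , refl ∷ []⊆-universal v , b<ᵇa
... | true  = let (c , c∈v , c≮a) = allBelow-false v a eq in c , b ∷ʳ c∈v , c≮a

allAbove-false : ∀ u v → allAbove u v ≡ false →
  Σ ℕ (λ a → Σ ℕ (λ b → ([ a ] ⊆ u) × ([ b ] ⊆ v) × ((b <ᵇ a) ≡ false)))
allAbove-false (a ∷ u) v eq with allBelow v a in below
... | false = let (b , b∈v , b≮a) = allBelow-false v a below in a , b , refl ∷ []⊆-universal u , b∈v , b≮a
... | true  = let (a′ , b , a′∈u , b∈v , b≮a′) = allAbove-false u v eq in a′ , b , a ∷ʳ a′∈u , b∈v , b≮a′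

[x]⊆-All : {P : ℕ → Set} → ∀ {x v} → [ x ] ⊆ v → All P v → P x
[x]⊆-All x∈v pv = All.lookup pv (to∈ x∈v)

Unique-separate : ∀ (u v : List ℕ) {a b} → Unique (u ++ v) → [ a ] ⊆ u → [ b ] ⊆ v → a ≢ b
Unique-separate (x ∷ u) v (_ ∷ uv)     (x ∷ʳ a∈u)   b∈v = Unique-separate u v uv a∈u b∈v
Unique-separate (x ∷ u) v (x∉uv ∷ _)   (refl ∷ _)   b∈v = [x]⊆-All b∈v (AllP.++⁻ʳ u x∉uv)

orderIso-132 : ∀ a b N → a < b → b < N → orderIso p132 (a ∷ N ∷ b ∷ []) ≡ true
orderIso-132 a b N a<b b<N
  rewrite <ᵇ-true a<b | <ᵇ-true b<N | <ᵇ-true (<-trans a<b b<N)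
        | <ᵇ-false a<b | <ᵇ-false b<N | <ᵇ-false (<-trans a<b b<N) = refl

inseparable-132 : Inseparable p132
inseparable-132 []                    _        _    ()
inseparable-132 (x ∷ [])              (y ∷ B₂) refl _ _  = refl
inseparable-132 (x ∷ y ∷ [])          (z ∷ B₂) refl _ _  = refl
inseparable-132 (x ∷ y ∷ z ∷ [])      []       refl _ ()
inseparable-132 (x ∷ y ∷ z ∷ w ∷ B₁)  B₂       ()

==ℕ0-+ : ∀ a b → ((a + b) ==ℕ 0) ≡ ((a ==ℕ 0) ∧ (b ==ℕ 0))
==ℕ0-+ zero    b = refl
==ℕ0-+ (suc a) b = refl

occ132-max-split : ∀ u v N → All (_< N) u → All (_< N) v → Above u v → occ p132 (u ++ N ∷ v) ≡ occ p132 v + occ p132 u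
occ132-max-split u v N u<N v<N u>v = begin
  occ p132 (u ++ N ∷ v)
    ≡⟨ cong (occ p132) (sym (++-assoc u (N ∷ []) v)) ⟩
  occ (concat (p132 ∷ [])) ((u ++ N ∷ []) ++ v)
    ≡⟨ occ-blocks-++ (p132 ∷ []) (u ++ N ∷ []) v (AllP.++⁺ u>v (v<N ∷ [])) (refl , tt) ((s≤s z≤n , inseparable-132) ∷ []) ⟩
  occ [] (u ++ N ∷ []) * occ p132 v + occ p132 (u ++ N ∷ []) * occ [] v
    ≡⟨ cong₂ (λ x y → x * occ p132 v + occ p132 (u ++ N ∷ []) * y) (occ-[] (u ++ N ∷ [])) (occ-[] v) ⟩
  1 * occ p132 v + occ p132 (u ++ N ∷ []) * 1
    ≡⟨ cong₂ _+_ (*-identityˡ (occ p132 v)) (*-identityʳ (occ p132 (u ++ N ∷ []))) ⟩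
  occ p132 v + occ ((1 ∷ 3 ∷ []) ++ 2 ∷ []) (u ++ N ∷ [])
    ≡⟨ cong (occ p132 v +_) (trans (occ-∷ʳ-max (1 ∷ 3 ∷ []) 2 u N u<N) (+-identityʳ _)) ⟩
  occ p132 v + occ p132 u ∎
  where open ≡-Reasoning

-- If some letter a of u lies below a letter b of v, then a N b is an occurrence of 132.
avoids132-max-split : ∀ u v N → All (_< N) u → All (_< N) v → Unique (u ++ v) →
  avoids p132 (u ++ N ∷ v) ≡ (allAbove u v ∧ (avoids p132 u ∧ avoids p132 v))
avoids132-max-split u v N u<N v<N uuv with allAbove u v in above
... | true  = trans (cong (_==ℕ 0) (occ132-max-split u v N u<N v<N (allAbove⇒Above u v above)))
                    (trans (==ℕ0-+ (occ p132 v) (occ p132 u)) (∧-comm (avoids p132 v) (avoids p132 u)))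
... | false with allAbove-false u v above
...   | a , b , a∈u , b∈v , b≮a =
  positive≢0 (occ-pos p132 (++⁺ a∈u (refl ∷ b∈v)) (orderIso-132 a b N a<b ([x]⊆-All b∈v v<N)))
  where
  positive≢0 : ∀ {k} → 1 ≤ k → (k ==ℕ 0) ≡ false
  positive≢0 {suc k} _ = refl
  a<b : a < b
  a<b with <-cmp a b
  ... | tri< a<b _ _ = a<b
  ... | tri≈ _ a≡b _ = ⊥-elim (Unique-separate u v uuv a∈u b∈v a≡b)
  ... | tri> _ _ b<a = ⊥-elim (subst T (trans (sym (<ᵇ-true b<a)) b≮a) tt)

avoids-shift : ∀ c τ γ → avoids τ (shift c γ) ≡ avoids τ γ
avoids-shift c τ γ = cong (_==ℕ 0) (occ-shiftʳ c τ γ)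

count≡Σ : ∀ (P : List ℕ → Bool) n → count P n ≡ Σl (perms n) (λ α → ind (P α))
count≡Σ P n = length-filterᵇ P (perms n)

count132-max-split : ∀ n (Q : List ℕ → Bool) →
  count (λ α → avoids p132 α ∧ Q α) (suc n) ≡
  Σn n (λ a → Σl (perms a) (λ γ → Σl (perms (n ∸ a)) (λ δ →
    ind (avoids p132 γ ∧ avoids p132 δ) * ind (Q (shift (n ∸ a) γ ++ suc n ∷ δ)))))
count132-max-split n Q = begin
  count P (suc n)
    ≡⟨ count≡Σ P (suc n) ⟩
  Σl (concatMap (insertAll (suc n)) (perms n)) (λ α → ind (P α))
    ≡⟨ Σl-concatMap (insertAll (suc n)) (perms n) _ ⟩
  Σl (perms n) (λ β → Σl (insertAll (suc n) β) (λ α → ind (P α)))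
    ≡⟨ Σl-cong-All (All.zipWith (λ x → x) (perms-bounded n , perms-unique n)) (λ β (bβ , uβ) → insert-max β bβ uβ) ⟩
  Σl (perms n) (splitSum F)
    ≡⟨ Σ-perms-splitSum n F ⟩
  maxSplitSum n F
    ≡⟨ Σn-cong n (λ a _ → Σl-cong (perms a) (λ γ → Σl-cong (perms (n ∸ a)) (λ δ →
         cong (λ z → ind (z ∧ avoids p132 δ) * ind (Q (shift (n ∸ a) γ ++ suc n ∷ δ))) (avoids-shift (n ∸ a) p132 γ)))) ⟩
  Σn n (λ a → Σl (perms a) (λ γ → Σl (perms (n ∸ a)) (λ δ →
    ind (avoids p132 γ ∧ avoids p132 δ) * ind (Q (shift (n ∸ a) γ ++ suc n ∷ δ))))) ∎
  where
  open ≡-Reasoning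
  P : List ℕ → Bool
  P α = avoids p132 α ∧ Q α
  F : List ℕ → List ℕ → ℕ
  F u v = ind (avoids p132 u ∧ avoids p132 v) * ind (Q (u ++ suc n ∷ v))
  per-split : ∀ u v → Bounded n (u ++ v) → Unique (u ++ v) → ind (P (u ++ suc n ∷ v)) ≡ ind (allAbove u v) * F u v
  per-split u v b uuv =
    trans (cong (λ z → ind (z ∧ Q (u ++ suc n ∷ v))) (avoids132-max-split u v (suc n) u<N v<N uuv))
    (trans (ind-∧ (allAbove u v ∧ (avoids p132 u ∧ avoids p132 v)) (Q (u ++ suc n ∷ v)))
    (trans (cong (_* ind (Q (u ++ suc n ∷ v))) (ind-∧ (allAbove u v) (avoids p132 u ∧ avoids p132 v)))
           (*-assoc (ind (allAbove u v)) _ _)))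
    where
    u<N : All (_< suc n) u
    u<N = All.map (λ (_ , x≤n) → s≤s x≤n) (AllP.++⁻ˡ u b)
    v<N : All (_< suc n) v
    v<N = All.map (λ (_ , x≤n) → s≤s x≤n) (AllP.++⁻ʳ u b)
  insert-max : ∀ β → Bounded n β → Unique β → Σl (insertAll (suc n) β) (λ α → ind (P α)) ≡ splitSum F β
  insert-max β bβ uβ = trans (cong (λ L → Σl L (λ α → ind (P α))) (insertAll-splits (suc n) β))
    (trans (Σl-map _ (splits β) (λ α → ind (P α)))
    (Σl-cong-All (splits-sound β) (λ (u , v) u++v≡β → per-split u v (subst (Bounded n) (sym u++v≡β) bβ) (subst Unique (sym u++v≡β) uβ))))

-- `block` and `range` run over `where`-bound counters of Defs that cannot be named; each
-- metavariable below is solved by unification to such a counter.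
mutual
  blockFrom : ℕ → ℕ → ℕ → ℕ → List ℕ
  blockFrom = _

  block-unfold : ∀ a b → block a b ≡ blockFrom a b (b ∸ a) (suc a)
  block-unfold a b with b ∸ a | suc a
  ... | k | s = refl

blockFrom≡iterate : ∀ a b k s → blockFrom a b k s ≡ iterate suc s k
blockFrom≡iterate a b zero    s = refl
blockFrom≡iterate a b (suc k) s = cong (s ∷_) (blockFrom≡iterate a b k (suc s))

block≡iterate : ∀ a b → block a b ≡ iterate suc (suc a) (b ∸ a)
block≡iterate a b = trans (block-unfold a b) (blockFrom≡iterate a b (b ∸ a) (suc a))

mutual
  rangeFrom : ℕ → ℕ → ℕ → List ℕ
  rangeFrom = _

  range-unfold : ∀ a b → range a b ≡ rangeFrom a b (suc b ∸ a)
  range-unfold a b with suc b ∸ a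
  ... | k = refl

mutual
  rangeStep : ℕ → ℕ → ℕ → ℕ → List ℕ
  rangeStep = _

  rangeFrom-suc : ∀ a b k → rangeFrom a b (suc k) ≡ a ∷ rangeStep a b k (suc a)
  rangeFrom-suc a b k with suc a
  ... | s = refl

rangeStep≡iterate : ∀ a b k s → rangeStep a b k s ≡ iterate suc s k
rangeStep≡iterate a b zero    s = refl
rangeStep≡iterate a b (suc k) s = cong (s ∷_) (rangeStep≡iterate a b k (suc s))

rangeFrom≡iterate : ∀ a b k → rangeFrom a b k ≡ iterate suc a k
rangeFrom≡iterate a b zero    = refl
rangeFrom≡iterate a b (suc k) = trans (rangeFrom-suc a b k) (cong (a ∷_) (rangeStep≡iterate a b k (suc a)))

range≡iterate : ∀ a b → range a b ≡ iterate suc a (suc b ∸ a)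
range≡iterate a b = trans (range-unfold a b) (rangeFrom≡iterate a b (suc b ∸ a))

iterate-suc-++ : ∀ s j k → iterate suc s (j + k) ≡ iterate suc s j ++ iterate suc (s + j) k
iterate-suc-++ s zero    k = cong (λ z → iterate suc z k) (sym (+-identityʳ s))
iterate-suc-++ s (suc j) k = cong (s ∷_) (trans (iterate-suc-++ (suc s) j k)
  (cong (λ z → iterate suc (suc s) j ++ iterate suc z k) (sym (+-suc s j))))

iterate-suc-∷ʳ : ∀ s k → iterate suc s (suc k) ≡ iterate suc s k ++ (s + k ∷ [])
iterate-suc-∷ʳ s k = trans (cong (iterate suc s) (+-comm 1 k)) (iterate-suc-++ s k 1)

map-+-iterate-suc : ∀ c s k → map (_+ c) (iterate suc s k) ≡ iterate suc (s + c) k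
map-+-iterate-suc c s zero    = refl
map-+-iterate-suc c s (suc k) = cong (s + c ∷_) (map-+-iterate-suc c (suc s) k)

iterate-suc-above : ∀ s k → All (s <_) (iterate suc (suc s) k)
iterate-suc-above s zero    = []
iterate-suc-above s (suc k) = ≤-refl ∷ All.map (<-trans (n<1+n s)) (iterate-suc-above (suc s) k)

iterate-suc-bounds : ∀ s k → All (λ x → (s ≤ x) × (x < s + k)) (iterate suc s k)
iterate-suc-bounds s zero    = []
iterate-suc-bounds s (suc k) =
  (≤-refl , subst (s <_) (sym (+-suc s k)) (s≤s (m≤m+n s k)))
  ∷ All.map (λ {x} (s<x , x<) → <⇒≤ s<x , subst (x <_) (sym (+-suc s k)) x<) (iterate-suc-bounds (suc s) k)

iterate-suc-allBelow : ∀ s k → allBelow (iterate suc s k) (s + k) ≡ true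
iterate-suc-allBelow s k = allBelow-true (All.map proj₂ (iterate-suc-bounds s k))

inseparable-head : ∀ x L → All (x <_) L → Inseparable (x ∷ L)
inseparable-head x L x<L []        _        _    ()
inseparable-head x L x<L (y ∷ B₁)  []       _    _ ()
inseparable-head x L x<L (.x ∷ B₁) (z ∷ B₂) refl _ _ with AllP.++⁻ʳ B₁ x<L
... | x<z ∷ _ rewrite <ᵇ-false x<z = refl

iterate-suc-inseparable : ∀ s k → Inseparable (iterate suc s k)
iterate-suc-inseparable s zero    []       _ _  ()
iterate-suc-inseparable s zero    (x ∷ B₁) _ ()
iterate-suc-inseparable s (suc k) = inseparable-head s (iterate suc (suc s) k) (iterate-suc-above s k)

layered-single : ∀ k → layered (k ∷ []) ≡ iterate suc 1 k
layered-single k = trans (++-identityʳ (block 0 k)) (block≡iterate 0 k)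

allAbove-[]ʳ : ∀ X → allAbove X [] ≡ true
allAbove-[]ʳ []      = refl
allAbove-[]ʳ (x ∷ X) = allAbove-[]ʳ X

module MaxSplit {a b N : ℕ} {γ δ : List ℕ} (bγ : Bounded a γ) (bδ : Bounded b δ) (a+b<N : a + b < N) where

  xs : List ℕ
  xs = shift b γ ++ N ∷ []

  shift-γ<N : All (_< N) (shift b γ)
  shift-γ<N = AllP.map⁺ (All.map (λ (_ , x≤a) → ≤-<-trans (+-monoˡ-≤ b x≤a) a+b<N) bγ)

  xs-above-δ : Above xs δ
  xs-above-δ = AllP.++⁺
    (AllP.map⁺ (All.map (λ (1≤x , _) → All.map (λ (_ , y≤b) → ≤-trans (s≤s y≤b) (+-monoˡ-≤ b 1≤x)) bδ) bγ))
    (All.map (λ (_ , y≤b) → ≤-<-trans (≤-trans y≤b (m≤n+m b a)) a+b<N) bδ ∷ [])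

  occ-blocks-max-split : ∀ bs → Descending bs → All Block bs → occ (concat bs) (shift b γ ++ N ∷ δ) ≡ occBlockSplit [] bs xs δ
  occ-blocks-max-split bs bs-desc bs-blocks =
    trans (cong (occ (concat bs)) (sym (++-assoc (shift b γ) (N ∷ []) δ))) (occ-blocks-++ bs xs δ xs-above-δ bs-desc bs-blocks)

  occ-xs-max : ∀ σ c → allAbove (c ∷ []) σ ≡ true → occ (σ ++ c ∷ []) xs ≡ occ (σ ++ c ∷ []) γ + occ σ γ
  occ-xs-max σ c c>σ =
    trans (occ-∷ʳ-max σ c (shift b γ) N shift-γ<N)
          (cong₂ _+_ (occ-shiftʳ b (σ ++ c ∷ []) γ)
                     (trans (cong (λ z → ind z * occ σ (shift b γ)) c>σ) (trans (+-identityʳ _) (occ-shiftʳ b σ γ))))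

  occ-xs-nonmax : ∀ σ c → allAbove (c ∷ []) σ ≡ false → occ (σ ++ c ∷ []) xs ≡ occ (σ ++ c ∷ []) γ
  occ-xs-nonmax σ c c≯σ =
    trans (occ-∷ʳ-max σ c (shift b γ) N shift-γ<N)
          (trans (cong (λ z → occ (σ ++ c ∷ []) (shift b γ) + ind z * occ σ (shift b γ)) c≯σ)
                 (trans (+-identityʳ _) (occ-shiftʳ b (σ ++ c ∷ []) γ)))

-- 132-avoiders avoiding 12⋯k

==ℕ0-∧-implied : ∀ p q → (1 ≤ p → 1 ≤ q) → ((p ==ℕ 0) ∧ (q ==ℕ 0)) ≡ (q ==ℕ 0)
==ℕ0-∧-implied zero    q       _   = refl
==ℕ0-∧-implied (suc p) zero    p⇒q with p⇒q (s≤s z≤n)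
... | ()
==ℕ0-∧-implied (suc p) (suc q) _   = refl

incAvoiders : ℕ → ℕ → ℕ
incAvoiders k = count (λ α → avoids p132 α ∧ avoids (layered (k ∷ [])) α)

incAvoiders-zero : ∀ n → incAvoiders 0 n ≡ 0
incAvoiders-zero n = trans (count≡Σ _ n) (Σl-zero (perms n) _ (λ α →
  trans (cong (λ z → ind (avoids p132 α ∧ (z ==ℕ 0))) (occ-[] α)) (cong ind (∧-zeroʳ (avoids p132 α)))))

Σ-perms-factor : ∀ a b (f g : List ℕ → ℕ) (h : List ℕ → List ℕ → ℕ) →
  (∀ γ δ → Bounded a γ → Bounded b δ → h γ δ ≡ f γ * g δ) →
  Σl (perms a) (λ γ → Σl (perms b) (h γ)) ≡ Σl (perms a) f * Σl (perms b) g
Σ-perms-factor a b f g h h≡f*g =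
  trans (Σl-cong-All (perms-bounded a) (λ γ bγ → Σl-cong-All (perms-bounded b) (λ δ bδ → h≡f*g γ δ bγ bδ)))
        (Σl-product (perms a) (perms b) f g)

-- shift γ ++ N ∷ δ contains 12⋯(k+1) iff δ does or γ contains 12⋯k.
avoids-inc-max-split : ∀ {a b N} k γ δ → Bounded a γ → Bounded b δ → a + b < N →
  ind (avoids p132 γ ∧ avoids p132 δ) * ind (avoids (layered (suc k ∷ [])) (shift b γ ++ N ∷ δ))
    ≡ ind (avoids p132 γ ∧ avoids (layered (k ∷ [])) γ) * ind (avoids p132 δ ∧ avoids (layered (suc k ∷ [])) δ)
avoids-inc-max-split {b = b} {N = N} k γ δ bγ bδ a+b<N = begin
  ind (A γ ∧ A δ) * ind (occ I (shift b γ ++ N ∷ δ) ==ℕ 0)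
    ≡⟨ cong (λ z → ind (A γ ∧ A δ) * ind (z ==ℕ 0)) occ-I ⟩
  ind (A γ ∧ A δ) * ind ((occ X δ + (occ X γ + occ X′ γ)) ==ℕ 0)
    ≡⟨ cong (λ z → ind (A γ ∧ A δ) * ind z) (trans (==ℕ0-+ (occ X δ) _) (cong ((occ X δ ==ℕ 0) ∧_)
         (trans (==ℕ0-+ (occ X γ) (occ X′ γ)) (==ℕ0-∧-implied (occ X γ) (occ X′ γ) X⇒X′)))) ⟩
  ind (A γ ∧ A δ) * ind ((occ X δ ==ℕ 0) ∧ (occ X′ γ ==ℕ 0))
    ≡⟨ cong₂ _*_ (ind-∧ (A γ) (A δ)) (ind-∧ (occ X δ ==ℕ 0) (occ X′ γ ==ℕ 0)) ⟩
  ind (A γ) * ind (A δ) * (ind (occ X δ ==ℕ 0) * ind (occ X′ γ ==ℕ 0))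
    ≡⟨ regroup (ind (A γ)) (ind (A δ)) (ind (occ X δ ==ℕ 0)) (ind (occ X′ γ ==ℕ 0)) ⟩
  ind (A γ) * ind (occ X′ γ ==ℕ 0) * (ind (A δ) * ind (occ X δ ==ℕ 0))
    ≡⟨ sym (cong₂ _*_ (ind-∧ (A γ) (occ X′ γ ==ℕ 0)) (ind-∧ (A δ) (occ X δ ==ℕ 0))) ⟩
  ind (A γ ∧ (occ X′ γ ==ℕ 0)) * ind (A δ ∧ (occ X δ ==ℕ 0))
    ≡⟨ sym (cong₂ (λ u v → ind (A γ ∧ (occ u γ ==ℕ 0)) * ind (A δ ∧ (occ v δ ==ℕ 0))) (layered-single k) (layered-single (suc k))) ⟩
  ind (A γ ∧ avoids I′ γ) * ind (A δ ∧ avoids I δ) ∎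
  where
  open ≡-Reasoning
  open MaxSplit bγ bδ a+b<N
  A = avoids p132
  I = layered (suc k ∷ [])
  I′ = layered (k ∷ [])
  X = iterate suc 1 (suc k)
  X′ = iterate suc 1 k
  regroup : ∀ x y z w → x * y * (z * w) ≡ x * w * (y * z)
  regroup = solve-∀
  X⇒X′ : 1 ≤ occ X γ → 1 ≤ occ X′ γ
  X⇒X′ = occ-prefix X′ (suc k ∷ []) γ ∘ subst (λ z → 1 ≤ occ z γ) (iterate-suc-∷ʳ 1 k)
  occ-I : occ I (shift b γ ++ N ∷ δ) ≡ occ X δ + (occ X γ + occ X′ γ)
  occ-I = begin
    occ I (shift b γ ++ N ∷ δ)
      ≡⟨ cong (λ z → occ z (shift b γ ++ N ∷ δ)) (trans (layered-single (suc k)) (sym (++-identityʳ X))) ⟩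
    occ (concat (X ∷ [])) (shift b γ ++ N ∷ δ)
      ≡⟨ occ-blocks-max-split (X ∷ []) (allAbove-[]ʳ X , tt) ((s≤s z≤n , iterate-suc-inseparable 1 (suc k)) ∷ []) ⟩
    occ [] xs * occ (X ++ []) δ + occ X xs * occ [] δ
      ≡⟨ cong₂ (λ u v → u * occ (X ++ []) δ + occ X xs * v) (occ-[] xs) (occ-[] δ) ⟩
    1 * occ (X ++ []) δ + occ X xs * 1
      ≡⟨ cong₂ _+_ (trans (*-identityˡ _) (cong (λ z → occ z δ) (++-identityʳ X))) (*-identityʳ _) ⟩
    occ X δ + occ X xs
      ≡⟨ cong (occ X δ +_) (trans (cong (λ z → occ z xs) (iterate-suc-∷ʳ 1 k))
           (trans (occ-xs-max X′ (suc k) (trans (∧-identityʳ _) (iterate-suc-allBelow 1 k)))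
                  (cong (λ z → occ z γ + occ X′ γ) (sym (iterate-suc-∷ʳ 1 k))))) ⟩
    occ X δ + (occ X γ + occ X′ γ) ∎

incAvoiders-suc : ∀ k n → incAvoiders (suc k) (suc n) ≡ Σn n (λ a → incAvoiders k a * incAvoiders (suc k) (n ∸ a))
incAvoiders-suc k n = trans (count132-max-split n (avoids (layered (suc k ∷ [])))) (Σn-cong n (λ a a≤n →
  trans (Σ-perms-factor a (n ∸ a) (λ γ → ind (avoids p132 γ ∧ avoids (layered (k ∷ [])) γ))
                                  (λ δ → ind (avoids p132 δ ∧ avoids (layered (suc k ∷ [])) δ)) _
           (λ γ δ bγ bδ → avoids-inc-max-split k γ δ bγ bδ (s≤s (≤-reflexive (m+[n∸m]≡n a≤n)))))
        (sym (cong₂ _*_ (count≡Σ _ a) (count≡Σ _ (n ∸ a))))))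

-- Exactly one term of Σ p j * s j equals 1

nextOr0 : ℕ → (ℕ → ℕ) → ℕ → ℕ
nextOr0 K p j = if j <ᵇ K then p (suc j) else 0

prevOr : ℕ → (ℕ → ℕ) → ℕ → ℕ
prevOr q s zero    = q
prevOr q s (suc j) = s j

uniqueTerm : ℕ → (ℕ → ℕ) → (ℕ → ℕ) → ℕ → ℕ → ℕ
uniqueTerm K p s q j = ind (p j ==ℕ 1) * ind (nextOr0 K p j ==ℕ 0) * (ind (s j ==ℕ 1) * ind (prevOr q s j ==ℕ 0))

SupportDown SupportUp : ℕ → (ℕ → ℕ) → Set
SupportDown K p = ∀ j → j < K → 1 ≤ p (suc j) → 1 ≤ p j
SupportUp   K s = ∀ j → j < K → 1 ≤ s j → 1 ≤ s (suc j)

ind-*-==1 : ∀ a b → ind ((a * b) ==ℕ 1) ≡ ind (a ==ℕ 1) * ind (b ==ℕ 1)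
ind-*-==1 zero          b             = refl
ind-*-==1 (suc zero)    zero          = refl
ind-*-==1 (suc zero)    (suc zero)    = refl
ind-*-==1 (suc zero)    (suc (suc b)) = refl
ind-*-==1 (suc (suc a)) zero          rewrite *-zeroʳ a = refl
ind-*-==1 (suc (suc a)) (suc b)       rewrite +-comm b (suc a * suc b) = refl

ind-==1-≥2 : ∀ x → 2 ≤ x → ind (x ==ℕ 1) ≡ 0
ind-==1-≥2 (suc (suc x)) _ = refl
ind-==1-≥2 (suc zero) (s≤s ())

Σn-zero : ∀ K (f : ℕ → ℕ) → (∀ j → j ≤ K → f j ≡ 0) → Σn K f ≡ 0
Σn-zero zero    f f≡0 = f≡0 0 z≤n
Σn-zero (suc K) f f≡0 = cong₂ _+_ (Σn-zero K f (λ j j≤K → f≡0 j (m≤n⇒m≤1+n j≤K))) (f≡0 (suc K) ≤-refl)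

Σn-head-≤ : ∀ K (f : ℕ → ℕ) → f 0 ≤ Σn K f
Σn-head-≤ zero    f = ≤-refl
Σn-head-≤ (suc K) f = ≤-trans (Σn-head-≤ K f) (m≤m+n _ _)

SupportDown-zero : ∀ K p → SupportDown K p → p 0 ≡ 0 → ∀ j → j ≤ K → p j ≡ 0
SupportDown-zero K p down p0≡0 zero    _   = p0≡0
SupportDown-zero K p down p0≡0 (suc j) j<K with p (suc j) in pj≡
... | zero  = refl
... | suc _ with down j j<K (subst (1 ≤_) (sym pj≡) (s≤s z≤n))
...   | p-pos rewrite SupportDown-zero K p down p0≡0 j (<⇒≤ j<K) with p-pos
...     | ()

*-pos : ∀ {a b} → 1 ≤ a → 1 ≤ b → 1 ≤ a * b
*-pos {suc a} {suc b} _ _ = s≤s z≤n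

uniqueTerms-head : ∀ K p s q →
  Σn (suc K) (uniqueTerm (suc K) p s q) ≡ uniqueTerm (suc K) p s q 0 + Σn K (uniqueTerm K (p ∘ suc) (s ∘ suc) (s 0))
uniqueTerms-head K p s q =
  trans (Σn-head K _) (cong (uniqueTerm (suc K) p s q 0 +_) (Σn-cong K (λ { zero _ → refl ; (suc i) _ → refl })))

first-product-==1 : ∀ K p s → SupportDown (suc K) p → SupportUp (suc K) s → 1 ≤ s 0 →
  ind ((p 0 * s 0 + Σn K (λ j → p (suc j) * s (suc j))) ==ℕ 1) ≡ ind (p 0 ==ℕ 1) * ind (p 1 ==ℕ 0) * ind (s 0 ==ℕ 1)
first-product-==1 K p s down up s0>0 with p 1 in p1≡
... | zero = begin
  ind ((p 0 * s 0 + Σn K (λ j → p (suc j) * s (suc j))) ==ℕ 1)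
    ≡⟨ cong (λ z → ind ((p 0 * s 0 + z) ==ℕ 1)) rest≡0 ⟩
  ind ((p 0 * s 0 + 0) ==ℕ 1)
    ≡⟨ cong (λ z → ind (z ==ℕ 1)) (+-identityʳ (p 0 * s 0)) ⟩
  ind ((p 0 * s 0) ==ℕ 1)
    ≡⟨ ind-*-==1 (p 0) (s 0) ⟩
  ind (p 0 ==ℕ 1) * ind (s 0 ==ℕ 1)
    ≡⟨ cong (_* ind (s 0 ==ℕ 1)) (sym (*-identityʳ (ind (p 0 ==ℕ 1)))) ⟩
  ind (p 0 ==ℕ 1) * 1 * ind (s 0 ==ℕ 1) ∎
  where
  open ≡-Reasoning
  rest≡0 : Σn K (λ j → p (suc j) * s (suc j)) ≡ 0
  rest≡0 = Σn-zero K _ (λ j j≤K → cong (_* s (suc j)) (SupportDown-zero K (p ∘ suc) (λ j j<K → down (suc j) (s≤s j<K)) p1≡ j j≤K))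
... | suc _ =
  trans (ind-==1-≥2 _ (+-mono-≤ (*-pos p0>0 s0>0) (≤-trans (*-pos p1>0 s1>0) (Σn-head-≤ K (λ j → p (suc j) * s (suc j))))))
        (sym (cong (_* ind (s 0 ==ℕ 1)) (*-zeroʳ (ind (p 0 ==ℕ 1)))))
  where
  p1>0 : 1 ≤ p 1
  p1>0 = subst (1 ≤_) (sym p1≡) (s≤s z≤n)
  p0>0 : 1 ≤ p 0
  p0>0 = down 0 (s≤s z≤n) p1>0
  s1>0 : 1 ≤ s 1
  s1>0 = up 0 (s≤s z≤n) s0>0

-- p has its support in an initial and s in a final segment of 0…K, so the products
-- p j * s j are positive on an interval; the sum is 1 iff that interval is a single j
-- with p j = s j = 1.
Σn-products-once : ∀ K p s q → SupportDown K p → SupportUp K s → (1 ≤ q → 1 ≤ s 0) →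
  ind (Σn K (λ j → p j * s j) ==ℕ 1) * ind (q ==ℕ 0) ≡ Σn K (uniqueTerm K p s q)
Σn-products-once zero p s q _ _ _ =
  trans (cong (_* ind (q ==ℕ 0)) (ind-*-==1 (p 0) (s 0))) (regroup (ind (p 0 ==ℕ 1)) (ind (s 0 ==ℕ 1)) (ind (q ==ℕ 0)))
  where
  regroup : ∀ a b c → a * b * c ≡ a * 1 * (b * c)
  regroup = solve-∀
Σn-products-once (suc K) p s q down up q⇒s0 =
  trans (cong (λ z → ind (z ==ℕ 1) * ind (q ==ℕ 0)) (Σn-head K (λ j → p j * s j))) (by-s0 (s 0) refl)
  where
  Σ′ = Σn K (λ j → p (suc j) * s (suc j))
  IH : ind (Σ′ ==ℕ 1) * ind (s 0 ==ℕ 0) ≡ Σn K (uniqueTerm K (p ∘ suc) (s ∘ suc) (s 0))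
  IH = Σn-products-once K (p ∘ suc) (s ∘ suc) (s 0) (λ j j<K → down (suc j) (s≤s j<K)) (λ j j<K → up (suc j) (s≤s j<K)) (up 0 (s≤s z≤n))
  by-s0 : ∀ x → s 0 ≡ x → ind ((p 0 * s 0 + Σ′) ==ℕ 1) * ind (q ==ℕ 0) ≡ Σn (suc K) (uniqueTerm (suc K) p s q)
  by-s0 zero s0≡0 = begin
    ind ((p 0 * s 0 + Σ′) ==ℕ 1) * ind (q ==ℕ 0)
      ≡⟨ cong₂ (λ u v → ind ((p 0 * u + Σ′) ==ℕ 1) * ind (v ==ℕ 0)) s0≡0 q≡0 ⟩
    ind ((p 0 * 0 + Σ′) ==ℕ 1) * 1
      ≡⟨ cong (λ z → ind ((z + Σ′) ==ℕ 1) * 1) (*-zeroʳ (p 0)) ⟩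
    ind (Σ′ ==ℕ 1) * ind (0 ==ℕ 0)
      ≡⟨ cong (λ z → ind (Σ′ ==ℕ 1) * ind (z ==ℕ 0)) (sym s0≡0) ⟩
    ind (Σ′ ==ℕ 1) * ind (s 0 ==ℕ 0)
      ≡⟨ IH ⟩
    Σn K (uniqueTerm K (p ∘ suc) (s ∘ suc) (s 0))
      ≡⟨ cong (_+ Σn K (uniqueTerm K (p ∘ suc) (s ∘ suc) (s 0))) (sym first-zero) ⟩
    uniqueTerm (suc K) p s q 0 + Σn K (uniqueTerm K (p ∘ suc) (s ∘ suc) (s 0))
      ≡⟨ sym (uniqueTerms-head K p s q) ⟩
    Σn (suc K) (uniqueTerm (suc K) p s q) ∎
    where
    open ≡-Reasoning
    first-zero : uniqueTerm (suc K) p s q 0 ≡ 0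
    first-zero rewrite s0≡0 = *-zeroʳ (ind (p 0 ==ℕ 1) * ind (p 1 ==ℕ 0))
    q≡0 : q ≡ 0
    q≡0 = n≤0⇒n≡0 (≮⇒≥ (λ q>0 → <-irrefl refl (subst (1 ≤_) s0≡0 (q⇒s0 q>0))))
  by-s0 (suc _) s0≡ = begin
    ind ((p 0 * s 0 + Σ′) ==ℕ 1) * ind (q ==ℕ 0)
      ≡⟨ cong (_* ind (q ==ℕ 0)) (first-product-==1 K p s down up s0>0) ⟩
    ind (p 0 ==ℕ 1) * ind (p 1 ==ℕ 0) * ind (s 0 ==ℕ 1) * ind (q ==ℕ 0)
      ≡⟨ *-assoc (ind (p 0 ==ℕ 1) * ind (p 1 ==ℕ 0)) (ind (s 0 ==ℕ 1)) (ind (q ==ℕ 0)) ⟩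
    uniqueTerm (suc K) p s q 0
      ≡⟨ sym (+-identityʳ _) ⟩
    uniqueTerm (suc K) p s q 0 + 0
      ≡⟨ cong (uniqueTerm (suc K) p s q 0 +_) rest≡0 ⟩
    uniqueTerm (suc K) p s q 0 + Σn K (uniqueTerm K (p ∘ suc) (s ∘ suc) (s 0))
      ≡⟨ sym (uniqueTerms-head K p s q) ⟩
    Σn (suc K) (uniqueTerm (suc K) p s q) ∎
    where
    open ≡-Reasoning
    s0>0 : 1 ≤ s 0
    s0>0 = subst (1 ≤_) (sym s0≡) (s≤s z≤n)
    rest≡0 : 0 ≡ Σn K (uniqueTerm K (p ∘ suc) (s ∘ suc) (s 0))
    rest≡0 = trans (sym (*-zeroʳ (ind (Σ′ ==ℕ 1)))) (trans (cong (λ z → ind (Σ′ ==ℕ 1) * ind (z ==ℕ 0)) (sym s0≡)) IH)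

compat-increasing : ∀ a b x y → a < b → compat (a , x) (b , y) ≡ true → x < y
compat-increasing a b x y a<b compat≡ rewrite <ᵇ-true a<b | <ᵇ-false a<b with x <ᵇ y in x<ᵇy
... | true = <ᵇ≡true⇒< x<ᵇy
compat-increasing a b x y a<b () | false

orderIso-first-two : ∀ a b σ x y s → a < b → orderIso (a ∷ b ∷ σ) (x ∷ y ∷ s) ≡ true → x < y
orderIso-first-two a b σ x y s a<b iso =
  compat-increasing a b x y a<b (proj₁ (∧≡true (proj₁ (∧≡true (proj₂ (∧≡true {length (a ∷ b ∷ σ) ==ℕ length (x ∷ y ∷ s)} iso))))))

-- Dropping the first or the last letter of an occurrence of 12⋯(k+2) gives two different
-- occurrences of 12⋯(k+1).
increasing-occ-doubles : ∀ k w → 1 ≤ occ (iterate suc 1 (suc (suc k))) w → 2 ≤ occ (iterate suc 1 (suc k)) w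
increasing-occ-doubles k w occ>0 with occ-witness (iterate suc 1 (suc (suc k))) w occ>0
... | s , s⊆w , iso with orderIso-++-split (1 ∷ []) (iterate suc 2 (suc k)) s iso
...   | []        , _      , _    , () , _
...   | _ ∷ _ ∷ _ , _      , _    , () , _
...   | _ ∷ []    , []     , _    , _  , ()
...   | x ∷ []    , y ∷ s₂ , refl , _  , iso-tail
  with orderIso-++-split (iterate suc 1 (suc k)) (suc (suc k) ∷ []) (x ∷ y ∷ s₂)
         (subst (λ z → orderIso z (x ∷ y ∷ s₂) ≡ true) (iterate-suc-∷ʳ 1 (suc k)) iso)
...     | []       , _ , _        , () , _
...     | x′ ∷ s₁  , t , s₁++t≡s , iso-init , _ =
  occ-two (iterate suc 1 (suc k)) (⊆-trans (++⁺ʳ t ⊆-refl) (subst (_⊆ w) (sym s₁++t≡s) s⊆w)) (⊆-trans (x ∷ʳ ⊆-refl) s⊆w)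
          heads-differ iso-init
          (trans (sym (orderIso-shiftˡ 1 (iterate suc 1 (suc k)) (y ∷ s₂)))
                 (trans (cong (λ z → orderIso z (y ∷ s₂)) (map-+-iterate-suc 1 1 (suc k))) iso-tail))
  where
  heads-differ : x′ ∷ s₁ ≢ y ∷ s₂
  heads-differ eq = <-irrefl (trans (sym (∷-injectiveˡ s₁++t≡s)) (∷-injectiveˡ eq))
                             (orderIso-first-two 1 2 (iterate suc 3 k) x y s₂ (s≤s (s≤s z≤n)) iso)

-- Counting sequences as power series

⟦_⟧ : (ℕ → ℕ) → PS
⟦ f ⟧ n = ℤ.+ f n

conv : (ℕ → ℕ) → (ℕ → ℕ) → ℕ → ℕ
conv f h n = Σn n (λ a → f a * h (n ∸ a))

⟦Σn⟧ : ∀ n (f : ℕ → ℕ) → ℤ.+ Σn n f ≡ Σto n ⟦ f ⟧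
⟦Σn⟧ zero    f = refl
⟦Σn⟧ (suc n) f = trans (ℤₚ.pos-+ (Σn n f) (f (suc n))) (cong (ℤ._+ ⟦ f ⟧ (suc n)) (⟦Σn⟧ n f))

⊛-⟦⟧ : ∀ {F H} f h → F ≋ ⟦ f ⟧ → H ≋ ⟦ h ⟧ → (F ⊛ H) ≋ ⟦ conv f h ⟧
⊛-⟦⟧ f h F≋f H≋h n =
  trans (Σto-cong n (λ i _ → trans (cong₂ ℤ._*_ (F≋f i) (H≋h (n ∸ i))) (sym (ℤₚ.pos-* (f i) (h (n ∸ i))))))
        (sym (⟦Σn⟧ n _))

ΣS-⟦⟧ : ∀ {P : ℕ → Set} L (F : ℕ → PS) (f : ℕ → ℕ → ℕ) → All P L →
  (∀ j → P j → F j ≋ ⟦ f j ⟧) → ΣS L F ≋ ⟦ (λ n → Σl L (λ j → f j n)) ⟧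
ΣS-⟦⟧ []      F f []       F≋f n = refl
ΣS-⟦⟧ (j ∷ L) F f (pj ∷ ps) F≋f n =
  trans (cong₂ ℤ._+_ (F≋f j pj n) (ΣS-⟦⟧ L F f ps F≋f n)) (sym (ℤₚ.pos-+ (f j n) (Σl L (λ j → f j n))))

R≋incAvoiders : ∀ k → R k ≋ ⟦ incAvoiders k ⟧
R≋incAvoiders = R≋solution (λ k → ⟦ incAvoiders k ⟧) (λ n → cong ℤ.+_ (incAvoiders-zero n)) incAvoiders-series
  where
  incAvoiders-series : ∀ k → ⟦ incAvoiders (suc k) ⟧ ≋ (1S ⊕ xS (⟦ incAvoiders k ⟧ ⊛ ⟦ incAvoiders (suc k) ⟧))
  incAvoiders-series k zero    = refl
  incAvoiders-series k (suc n) =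
    trans (cong ℤ.+_ (incAvoiders-suc k n))
          (trans (sym (⊛-⟦⟧ (incAvoiders k) (incAvoiders (suc k)) (λ _ → refl) (λ _ → refl) n)) (sym (ℤₚ.+-identityˡ _)))

Σperms : (List ℕ → ℕ) → ℕ → ℕ
Σperms g k = Σl (perms k) g

Gρ-nonempty : ∀ ρ σ → 0 < length σ → Gρ ρ σ ≋ ⟦ Σperms (λ α → ind (avoids p132 α) * (ind (avoids ρ α) * ind (onceIn σ α))) ⟧
Gρ-nonempty ρ (t ∷ σ) _ n = cong ℤ.+_ (trans (count≡Σ _ n) (Σl-cong (perms n) (λ α →
  trans (ind-∧ (avoids p132 α) _) (cong (ind (avoids p132 α) *_) (ind-∧ (avoids ρ α) (onceIn (t ∷ σ) α))))))

G≋ : ∀ σ → G σ ≋ ⟦ Σperms (λ α → ind (avoids p132 α) * ind (onceIn σ α)) ⟧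
G≋ σ n = cong ℤ.+_ (trans (count≡Σ _ n) (Σl-cong (perms n) (λ α → ind-∧ (avoids p132 α) (onceIn σ α))))

R≋ : ∀ k → R k ≋ ⟦ Σperms (λ α → ind (avoids p132 α) * ind (avoids (layered (k ∷ [])) α)) ⟧
R≋ k n = trans (R≋incAvoiders k n) (cong ℤ.+_ (trans (count≡Σ _ n) (Σl-cong (perms n) (λ α → ind-∧ (avoids p132 α) _))))

layered-map-iterate : ∀ (f : ℕ → ℕ) a k → f (a + k) ≡ 0 →
  layered (map f (iterate suc a k)) ≡ concat (map (λ i → block (f (suc i)) (f i)) (iterate suc a k))
layered-map-iterate f a zero          _     = refl
layered-map-iterate f a (suc zero)    f≡0   = cong (λ z → block z (f a) ++ []) (sym (trans (cong f (sym (+-comm a 1))) f≡0))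
layered-map-iterate f a (suc (suc k)) f≡0   =
  cong (block (f (suc a)) (f a) ++_) (layered-map-iterate f (suc a) (suc k) (trans (cong f (sym (+-suc a (suc k)))) f≡0))

Above⇒allAbove : ∀ {U V} → Above U V → allAbove U V ≡ true
Above⇒allAbove []          = refl
Above⇒allAbove (V<a ∷ U>V) rewrite allBelow-true V<a = Above⇒allAbove U>V

∸-suc : ∀ K j → j < K → K ∸ j ≡ suc (K ∸ suc j)
∸-suc (suc K) zero    _         = refl
∸-suc (suc K) (suc j) (s≤s j<K) = ∸-suc K j j<K

∸-cancelʳ : ∀ a b c → c ≤ b → b ≤ a → (a ∸ c) ∸ (b ∸ c) ≡ a ∸ b
∸-cancelʳ a b c c≤b b≤a = trans (cong (_∸ (b ∸ c)) a∸c≡) (m+n∸n≡m (a ∸ b) (b ∸ c))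
  where
  a∸c≡ : a ∸ c ≡ (a ∸ b) + (b ∸ c)
  a∸c≡ = trans (cong (_∸ c) (sym (m∸n+n≡m b≤a))) (+-∸-assoc (a ∸ b) c≤b)

∷ʳ-view : ∀ (L : List ℕ) → 0 < length L → Σ (List ℕ) (λ U → Σ ℕ (λ c → L ≡ U ++ c ∷ []))
∷ʳ-view (x ∷ [])    _ = [] , x , refl
∷ʳ-view (x ∷ y ∷ L) _ with ∷ʳ-view (y ∷ L) (s≤s z≤n)
... | U , c , eq = x ∷ U , c , cong (x ∷_) eq

==ℕ1-+-implied : ∀ a b → (1 ≤ a → 2 ≤ b) → ind ((a + b) ==ℕ 1) ≡ ind (b ==ℕ 1)
==ℕ1-+-implied zero    b _   = refl
==ℕ1-+-implied (suc a) b a⇒b with a⇒b (s≤s z≤n)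
... | s≤s (s≤s {n = b′} _) rewrite +-suc a (suc b′) = refl

<ᵇ-irrefl : ∀ n → (n <ᵇ n) ≡ false
<ᵇ-irrefl zero    = refl
<ᵇ-irrefl (suc n) = <ᵇ-irrefl n

-- The layers of τ = [m 0, …, m r], where K = r + 1 is the number of layers

module Layers (r′ : ℕ) (m : ℕ → ℕ) (m-dec : ∀ i → i ≤ suc r′ → m (suc i) < m i) (m-last : m (suc (suc r′)) ≡ 0) where

  r K : ℕ
  r = suc r′
  K = suc r

  m-antitone : ∀ i j → i ≤ j → j ≤ K → m j ≤ m i
  m-antitone i j i≤j j≤K = subst (λ z → m z ≤ m i) (m+[n∸m]≡n i≤j) (steps (j ∸ i) (subst (_≤ K) (sym (m+[n∸m]≡n i≤j)) j≤K))
    where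
    steps : ∀ k → i + k ≤ K → m (i + k) ≤ m i
    steps zero    _     = ≤-reflexive (cong m (+-identityʳ i))
    steps (suc k) i+k<K = ≤-trans (<⇒≤ (subst (λ z → m z < m (i + k)) (sym (+-suc i k)) (m-dec (i + k) (≤-pred i+k+1≤K))))
                                  (steps k (≤-trans (n≤1+n (i + k)) i+k+1≤K))
      where
      i+k+1≤K : suc (i + k) ≤ K
      i+k+1≤K = subst (_≤ K) (+-suc i k) i+k<K

  layer : ℕ → List ℕ
  layer i = iterate suc (suc (m (suc i))) (m i ∸ m (suc i))

  layersFrom : ℕ → ℕ → List ℕ
  layersFrom i k = concat (map layer (iterate suc i k))

  prefix suffix : ℕ → List ℕ
  prefix j = layersFrom 0 j
  suffix j = layersFrom j (K ∸ j)

  τ : List ℕ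
  τ = layered (map m (range 0 r))

  d d′ : ℕ
  d  = m 0 ∸ m 1
  d′ = d ∸ 1

  d≡suc-d′ : d ≡ suc d′
  d≡suc-d′ = sym (m+[n∸m]≡n (m<n⇒0<n∸m (m-dec 0 z≤n)))

  stdPrefix suffixPattern : ℕ → List ℕ
  stdPrefix j     = layered (map (λ i → m i ∸ m j) (range 0 (j ∸ 1)))
  suffixPattern j = layered (map m (range j r))

  ρ₁ τ₁ : List ℕ
  ρ₁ = layered ((m 0 ∸ m 2) ∷ (m 1 ∸ m 2) ∷ [])
  τ₁ = layered (d′ ∷ [])

  prefix-suc : ∀ j → prefix (suc j) ≡ prefix j ++ layer j
  prefix-suc j = begin
    concat (map layer (iterate suc 0 (suc j)))           ≡⟨ cong (λ L → concat (map layer L)) (iterate-suc-∷ʳ 0 j) ⟩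
    concat (map layer (iterate suc 0 j ++ j ∷ []))       ≡⟨ cong concat (map-++ layer (iterate suc 0 j) (j ∷ [])) ⟩
    concat (map layer (iterate suc 0 j) ++ layer j ∷ []) ≡⟨ sym (concat-++ (map layer (iterate suc 0 j)) (layer j ∷ [])) ⟩
    prefix j ++ (layer j ++ [])                          ≡⟨ cong (prefix j ++_) (++-identityʳ (layer j)) ⟩
    prefix j ++ layer j ∎
    where open ≡-Reasoning

  suffix-∷ : ∀ j → j < K → suffix j ≡ layer j ++ suffix (suc j)
  suffix-∷ j j<K = cong (layersFrom j) (∸-suc K j j<K)

  layer-nonempty : ∀ j → j < K → 0 < length (layer j)
  layer-nonempty j j<K = subst (0 <_) (sym (length-iterate suc _ _)) (m<n⇒0<n∸m (m-dec j (≤-pred j<K)))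

  layer-bounds : ∀ j → j < K → All (λ x → (m (suc j) < x) × (x ≤ m j)) (layer j)
  layer-bounds j j<K = All.map (λ {x} (m<x , x<) → m<x , ≤-pred (subst (x <_) (cong suc (m+[n∸m]≡n (<⇒≤ (m-dec j (≤-pred j<K))))) x<))
                               (iterate-suc-bounds _ _)

  layersFrom≤ : ∀ c k → c + k ≤ K → All (_≤ m c) (layersFrom c k)
  layersFrom≤ c zero    _     = []
  layersFrom≤ c (suc k) c+k<K = AllP.++⁺ (All.map proj₂ (layer-bounds c c<K))
    (All.map (λ x≤ → ≤-trans x≤ (<⇒≤ (m-dec c (≤-pred c<K)))) (layersFrom≤ (suc c) k (subst (_≤ K) (+-suc c k) c+k<K)))
    where
    c<K : c < K
    c<K = ≤-trans (s≤s (m≤m+n c k)) (subst (_≤ K) (+-suc c k) c+k<K)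

  layers-descending : ∀ c k → c + k ≤ K → Descending (map layer (iterate suc c k))
  layers-descending c zero    _     = tt
  layers-descending c (suc k) c+k<K =
    Above⇒allAbove (All.map (λ (m<x , _) → All.map (λ y≤ → ≤-<-trans y≤ m<x) (layersFrom≤ (suc c) k c+1+k≤K)) (layer-bounds c c<K))
    , layers-descending (suc c) k c+1+k≤K
    where
    c+1+k≤K : suc c + k ≤ K
    c+1+k≤K = subst (_≤ K) (+-suc c k) c+k<K
    c<K : c < K
    c<K = ≤-trans (s≤s (m≤m+n c k)) c+1+k≤K

  layers-blocks : ∀ c k → c + k ≤ K → All Block (map layer (iterate suc c k))
  layers-blocks c zero    _     = []
  layers-blocks c (suc k) c+k<K =
    (layer-nonempty c (≤-trans (s≤s (m≤m+n c k)) c+1+k≤K) , iterate-suc-inseparable _ _) ∷ layers-blocks (suc c) k c+1+k≤K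
    where
    c+1+k≤K : suc c + k ≤ K
    c+1+k≤K = subst (_≤ K) (+-suc c k) c+k<K

  suffixPattern≡suffix : ∀ j → j ≤ K → suffixPattern j ≡ suffix j
  suffixPattern≡suffix j j≤K =
    trans (cong (λ L → layered (map m L)) (range≡iterate j r))
    (trans (layered-map-iterate m j (K ∸ j) (trans (cong m (m+[n∸m]≡n j≤K)) m-last))
           (cong concat (map-cong (λ i → block≡iterate (m (suc i)) (m i)) (iterate suc j (K ∸ j)))))

  τ≡prefix : τ ≡ prefix K
  τ≡prefix = suffixPattern≡suffix 0 z≤n

  shift-stdPrefix : ∀ j → 1 ≤ j → j ≤ K → shift (m j) (stdPrefix j) ≡ prefix j
  shift-stdPrefix (suc j′) _ j≤K =
    trans (cong (shift (m j)) (trans (cong (λ L → layered (map f L)) (range≡iterate 0 j′)) (layered-map-iterate f 0 j (n∸n≡0 (m j)))))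
    (trans (sym (concat-map (map (λ i → block (f (suc i)) (f i)) (iterate suc 0 j))))
           (cong concat (trans (sym (map-∘ (iterate suc 0 j))) (map-cong-All (iterate-suc-bounds 0 j) (λ i (_ , i<j) → shift-block i i<j)))))
    where
    j = suc j′
    f = λ i → m i ∸ m j
    map-cong-All : {A B : Set} {P : A → Set} {g h : A → B} {L : List A} → All P L → (∀ x → P x → g x ≡ h x) → map g L ≡ map h L
    map-cong-All []         g≡h = refl
    map-cong-All (px ∷ pxs) g≡h = cong₂ _∷_ (g≡h _ px) (map-cong-All pxs g≡h)
    shift-block : ∀ i → i < j → shift (m j) (block (f (suc i)) (f i)) ≡ layer i
    shift-block i i<j =
      trans (cong (shift (m j)) (block≡iterate (f (suc i)) (f i)))
      (trans (map-+-iterate-suc (m j) (suc (f (suc i))) (f i ∸ f (suc i)))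
             (cong₂ (iterate suc) (cong suc (m∸n+n≡m mj≤))
                    (∸-cancelʳ (m i) (m (suc i)) (m j) mj≤ (<⇒≤ (m-dec i (≤-pred (≤-trans i<j j≤K)))))))
      where
      mj≤ : m j ≤ m (suc i)
      mj≤ = m-antitone (suc i) j i<j j≤K

  occ-prefix≡stdPrefix : ∀ j w → 1 ≤ j → j ≤ K → occ (prefix j) w ≡ occ (stdPrefix j) w
  occ-prefix≡stdPrefix j w 1≤j j≤K = trans (cong (λ z → occ z w) (sym (shift-stdPrefix j 1≤j j≤K))) (occ-shiftˡ (m j) (stdPrefix j) w)

  prefix-nonempty : ∀ j → j < K → 0 < length (prefix (suc j))
  prefix-nonempty j j<K = ≤-trans (layer-nonempty j j<K)
    (subst (length (layer j) ≤_) (trans (sym (length-++ (prefix j))) (cong length (sym (prefix-suc j)))) (m≤n+m _ _))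

  suffix-nonempty : ∀ j → j < K → 0 < length (suffix j)
  suffix-nonempty j j<K = ≤-trans (layer-nonempty j j<K)
    (subst (length (layer j) ≤_) (trans (sym (length-++ (layer j))) (cong length (sym (suffix-∷ j j<K)))) (m≤m+n _ _))

  stdPrefix-nonempty : ∀ j → 1 ≤ j → j ≤ K → 0 < length (stdPrefix j)
  stdPrefix-nonempty (suc j) 1≤j j<K =
    subst (0 <_) (trans (cong length (sym (shift-stdPrefix (suc j) 1≤j j<K))) (length-map (_+ m (suc j)) (stdPrefix (suc j))))
          (prefix-nonempty j j<K)

  suffixPattern-nonempty : ∀ j → j ≤ r → 0 < length (suffixPattern j)
  suffixPattern-nonempty j j≤r =
    subst (λ z → 0 < length z) (sym (suffixPattern≡suffix j (≤-trans j≤r (n≤1+n r)))) (suffix-nonempty j (s≤s j≤r))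

  -- The last letter of prefix (i + 2) lies in layer (i + 1), below the first letter m 1 + 1.
  prefix-last-nonmax : ∀ i → suc (suc i) ≤ K →
    Σ (List ℕ) (λ σ → Σ ℕ (λ c → (prefix (suc (suc i)) ≡ σ ++ c ∷ []) × (allAbove (c ∷ []) σ ≡ false)))
  prefix-last-nonmax i i+2≤K with ∷ʳ-view (layer (suc i)) (layer-nonempty (suc i) i+2≤K)
  ... | U , c , layer≡ = suc (m 1) ∷ (rest ++ U) , c , prefix≡ , c≯m1
    where
    rest = iterate suc (suc (suc (m 1))) d′ ++ layersFrom 1 i
    prefix≡ : prefix (suc (suc i)) ≡ (suc (m 1) ∷ (rest ++ U)) ++ c ∷ []
    prefix≡ = trans (prefix-suc (suc i))
      (trans (cong₂ _++_ (cong (λ k → iterate suc (suc (m 1)) k ++ layersFrom 1 i) d≡suc-d′) layer≡)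
             (cong (suc (m 1) ∷_) (sym (++-assoc rest U (c ∷ [])))))
    c≤ : c ≤ m (suc i)
    c≤ = proj₂ (All.head (AllP.++⁻ʳ U (subst (All _) layer≡ (layer-bounds (suc i) i+2≤K))))
    c≯m1 : allAbove (c ∷ []) (suc (m 1) ∷ (rest ++ U)) ≡ false
    c≯m1 rewrite <ᵇ-false (s≤s (≤-trans c≤ (m-antitone 1 (suc i) (s≤s z≤n) (≤-trans (n≤1+n (suc i)) i+2≤K)))) = refl

  prefix1≡ : prefix 1 ≡ iterate suc (suc (m 1)) d′ ++ (suc (m 1) + d′ ∷ [])
  prefix1≡ = trans (++-identityʳ (layer 0)) (trans (cong (iterate suc (suc (m 1))) d≡suc-d′) (iterate-suc-∷ʳ (suc (m 1)) d′))

  occ-iterate-suc-shift : ∀ c k w → occ (iterate suc (suc c) k) w ≡ occ (iterate suc 1 k) w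
  occ-iterate-suc-shift c k w = trans (cong (λ z → occ z w) (sym (map-+-iterate-suc c 1 k))) (occ-shiftˡ c (iterate suc 1 k) w)

  occBlockSplit-layers : ∀ xs δ i k → occBlockSplit (prefix i) (map layer (iterate suc i k)) xs δ
    ≡ Σn k (λ l → occ (prefix (i + l)) xs * occ (layersFrom (i + l) (k ∸ l)) δ)
  occBlockSplit-layers xs δ i zero    = cong (λ z → occ (prefix z) xs * occ [] δ) (sym (+-identityʳ i))
  occBlockSplit-layers xs δ i (suc k) =
    trans (cong₂ _+_ (cong (λ z → occ (prefix z) xs * occ (layersFrom z (suc k)) δ) (sym (+-identityʳ i)))
                     (trans (cong (λ Z → occBlockSplit Z (map layer (iterate suc (suc i) k)) xs δ) (sym (prefix-suc i)))
                            (trans (occBlockSplit-layers xs δ (suc i) k)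
                                   (Σn-cong k (λ l _ → cong (λ z → occ (prefix z) xs * occ (layersFrom z (k ∸ l)) δ) (sym (+-suc i l)))))))
          (sym (Σn-head k _))

  -- An occurrence of τ in shift γ ++ N ∷ δ takes its first j layers from xs = shift γ ++ [N]
  -- and the others from δ.
  module Split {a b N : ℕ} {γ δ : List ℕ} (bγ : Bounded a γ) (bδ : Bounded b δ) (a+b<N : a + b < N) where
    open MaxSplit bγ bδ a+b<N

    p s : ℕ → ℕ
    p j = occ (prefix j) xs
    s j = occ (suffix j) δ

    occ-τ-split : occ τ (shift b γ ++ N ∷ δ) ≡ Σn K (λ j → p j * s j)
    occ-τ-split =
      trans (cong (λ z → occ z (shift b γ ++ N ∷ δ)) τ≡prefix)
            (trans (occ-blocks-max-split (map layer (iterate suc 0 K)) (layers-descending 0 K ≤-refl) (layers-blocks 0 K ≤-refl))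
                   (occBlockSplit-layers xs δ 0 K))

    p-supportDown : SupportDown K p
    p-supportDown j _ p>0 = occ-prefix (prefix j) (layer j) xs (subst (λ z → 1 ≤ occ z xs) (prefix-suc j) p>0)

    s-supportUp : SupportUp K s
    s-supportUp j j<K s>0 = occ-suffix (layer j) (suffix (suc j)) δ (subst (λ z → 1 ≤ occ z δ) (suffix-∷ j j<K) s>0)

    onceIn-τ-split : ind (onceIn τ (shift b γ ++ N ∷ δ)) ≡ Σn K (uniqueTerm K p s 0)
    onceIn-τ-split = trans (sym (*-identityʳ _)) (trans (cong (λ z → ind (z ==ℕ 1) * 1) occ-τ-split)
                                                         (Σn-products-once K p s 0 p-supportDown s-supportUp (λ ())))

    p₀≡1 : p 0 ≡ 1
    p₀≡1 = occ-[] xs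

    p₁≡ : p 1 ≡ occ (iterate suc 1 d) γ + occ (iterate suc 1 d′) γ
    p₁≡ = trans (cong (λ z → occ z xs) prefix1≡)
      (trans (occ-xs-max (iterate suc (suc (m 1)) d′) (suc (m 1) + d′) (trans (∧-identityʳ _) (iterate-suc-allBelow (suc (m 1)) d′)))
      (cong₂ _+_ (trans (cong (λ z → occ z γ) (sym (trans (cong (iterate suc (suc (m 1))) d≡suc-d′) (iterate-suc-∷ʳ (suc (m 1)) d′))))
                        (occ-iterate-suc-shift (m 1) d γ))
                 (occ-iterate-suc-shift (m 1) d′ γ)))

    p-nonmax : ∀ i → suc (suc i) ≤ K → p (suc (suc i)) ≡ occ (prefix (suc (suc i))) γ
    p-nonmax i i+2≤K with prefix-last-nonmax i i+2≤K
    ... | σ , c , prefix≡ , c≯σ =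
      trans (cong (λ z → occ z xs) prefix≡) (trans (occ-xs-nonmax σ c c≯σ) (cong (λ z → occ z γ) (sym prefix≡)))

    s-K≡1 : s K ≡ 1
    s-K≡1 = trans (cong (λ z → occ (layersFrom K z) δ) (n∸n≡0 K)) (occ-[] δ)

    s-r≡ : s r ≡ occ (iterate suc 1 (m r)) δ
    s-r≡ = trans (cong (λ z → occ (layersFrom r z) δ) (trans (∸-suc K r ≤-refl) (cong suc (n∸n≡0 K))))
                 (cong (λ z → occ z δ) (trans (++-identityʳ (layer r)) (cong₂ (λ u v → iterate suc (suc u) (m r ∸ v)) m-last m-last)))

  g₀ h₀ g₁ h₁ gK hK : List ℕ → ℕ
  g₀ γ = ind (avoids p132 γ) * ind (avoids τ₁ γ)
  h₀ δ = ind (avoids p132 δ) * ind (onceIn τ δ)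
  g₁ γ = ind (avoids p132 γ) * (ind (avoids ρ₁ γ) * ind ((occ (iterate suc 1 d) γ + occ (iterate suc 1 d′) γ) ==ℕ 1))
  h₁ δ = ind (avoids p132 δ) * (ind (avoids τ δ) * ind (onceIn (suffixPattern 1) δ))
  gK γ = ind (avoids p132 γ) * ind (onceIn τ γ)
  hK δ = ind (avoids p132 δ) * ind (avoids (layered (m r ∷ [])) δ)

  gⱼ hⱼ : ℕ → List ℕ → ℕ
  gⱼ j γ = ind (avoids p132 γ) * (ind (avoids (stdPrefix (suc j)) γ) * ind (onceIn (stdPrefix j) γ))
  hⱼ j δ = ind (avoids p132 δ) * (ind (avoids (suffixPattern (j ∸ 1)) δ) * ind (onceIn (suffixPattern j) δ))

  -- Each term of the unique-occurrence sum factors into a condition on γ and one on δ.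
  module Terms {a b N : ℕ} {γ δ : List ℕ} (bγ : Bounded a γ) (bδ : Bounded b δ) (a+b<N : a + b < N) where
    open MaxSplit bγ bδ a+b<N
    open Split bγ bδ a+b<N

    Aγ Aδ : ℕ
    Aγ = ind (avoids p132 γ)
    Aδ = ind (avoids p132 δ)

    term : ℕ → ℕ
    term = uniqueTerm K p s 0

    term-factors : ∀ j → Aγ * Aδ * term j
      ≡ (Aγ * (ind (nextOr0 K p j ==ℕ 0) * ind (p j ==ℕ 1))) * (Aδ * (ind (prevOr 0 s j ==ℕ 0) * ind (s j ==ℕ 1)))
    term-factors j = regroup Aγ Aδ (ind (p j ==ℕ 1)) (ind (nextOr0 K p j ==ℕ 0)) (ind (s j ==ℕ 1)) (ind (prevOr 0 s j ==ℕ 0))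
      where
      regroup : ∀ A B x₁ x₂ y₁ y₂ → A * B * (x₁ * x₂ * (y₁ * y₂)) ≡ (A * (x₂ * x₁)) * (B * (y₂ * y₁))
      regroup = solve-∀

    term-0 : Aγ * Aδ * term 0 ≡ g₀ γ * h₀ δ
    term-0 = trans (term-factors 0) (cong₂ (λ u v → (Aγ * u) * (Aδ * v)) γ-part δ-part)
      where
      γ-part : ind (p 1 ==ℕ 0) * ind (p 0 ==ℕ 1) ≡ ind (avoids τ₁ γ)
      γ-part = trans (cong₂ (λ u v → ind (u ==ℕ 0) * ind (v ==ℕ 1)) p₁≡ p₀≡1)
        (trans (*-identityʳ _)
        (trans (cong ind (trans (==ℕ0-+ (occ (iterate suc 1 d) γ) (occ (iterate suc 1 d′) γ))
                                (==ℕ0-∧-implied (occ (iterate suc 1 d) γ) (occ (iterate suc 1 d′) γ) d⇒d′)))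
               (cong (λ z → ind (occ z γ ==ℕ 0)) (sym (layered-single d′)))))
        where
        d⇒d′ : 1 ≤ occ (iterate suc 1 d) γ → 1 ≤ occ (iterate suc 1 d′) γ
        d⇒d′ = occ-prefix (iterate suc 1 d′) (1 + d′ ∷ []) γ
             ∘ subst (λ z → 1 ≤ occ z γ) (trans (cong (iterate suc 1) d≡suc-d′) (iterate-suc-∷ʳ 1 d′))
      δ-part : ind (prevOr 0 s 0 ==ℕ 0) * ind (s 0 ==ℕ 1) ≡ ind (onceIn τ δ)
      δ-part = trans (*-identityˡ _) (cong (λ z → ind (occ z δ ==ℕ 1)) (sym τ≡prefix))

    term-1 : Aγ * Aδ * term 1 ≡ g₁ γ * h₁ δ
    term-1 = trans (term-factors 1) (cong₂ (λ u v → (Aγ * u) * (Aδ * v))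
      (cong₂ (λ u v → ind (u ==ℕ 0) * ind (v ==ℕ 1))
             (trans (p-nonmax 0 (s≤s (s≤s z≤n))) (occ-prefix≡stdPrefix 2 γ (s≤s z≤n) (s≤s (s≤s z≤n)))) p₁≡)
      (cong₂ (λ u v → ind (occ u δ ==ℕ 0) * ind (occ v δ ==ℕ 1)) (sym τ≡prefix) (sym (suffixPattern≡suffix 1 (s≤s z≤n)))))

    term-K : Aγ * Aδ * term K ≡ gK γ * hK δ
    term-K = trans (term-factors K) (cong₂ (λ u v → (Aγ * u) * (Aδ * v)) γ-part δ-part)
      where
      γ-part : ind (nextOr0 K p K ==ℕ 0) * ind (p K ==ℕ 1) ≡ ind (onceIn τ γ)
      γ-part = trans (cong (λ z → ind ((if z then p (suc K) else 0) ==ℕ 0) * ind (p K ==ℕ 1)) (<ᵇ-irrefl K))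
               (trans (*-identityˡ _) (cong (λ z → ind (z ==ℕ 1)) (trans (p-nonmax r′ ≤-refl) (cong (λ z → occ z γ) (sym τ≡prefix)))))
      δ-part : ind (prevOr 0 s K ==ℕ 0) * ind (s K ==ℕ 1) ≡ ind (avoids (layered (m r ∷ [])) δ)
      δ-part = trans (cong₂ (λ u v → ind (u ==ℕ 0) * ind (v ==ℕ 1)) s-r≡ s-K≡1)
               (trans (*-identityʳ _) (cong (λ z → ind (occ z δ ==ℕ 0)) (sym (layered-single (m r)))))

    term-j : ∀ i → suc (suc i) ≤ r → Aγ * Aδ * term (suc (suc i)) ≡ gⱼ (suc (suc i)) γ * hⱼ (suc (suc i)) δ
    term-j i j≤r = trans (term-factors j) (cong₂ (λ u v → (Aγ * u) * (Aδ * v))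
      (cong₂ (λ u v → ind (u ==ℕ 0) * ind (v ==ℕ 1))
             (trans (cong (λ z → if z then p (suc j) else 0) (<ᵇ-true (s≤s j≤r)))
                    (trans (p-nonmax (suc i) (s≤s j≤r)) (occ-prefix≡stdPrefix (suc j) γ (s≤s z≤n) (s≤s j≤r))))
             (trans (p-nonmax i j≤K) (occ-prefix≡stdPrefix j γ (s≤s z≤n) j≤K)))
      (cong₂ (λ u v → ind (occ u δ ==ℕ 0) * ind (occ v δ ==ℕ 1))
             (sym (suffixPattern≡suffix (suc i) (≤-trans (n≤1+n (suc i)) j≤K))) (sym (suffixPattern≡suffix j j≤K))))
      where
      j = suc (suc i)
      j≤K : j ≤ K
      j≤K = ≤-trans j≤r (n≤1+n r)

  middle : List ℕ
  middle = iterate suc 2 r′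

  Σn-split-ends : ∀ (f : ℕ → ℕ) → Σn K f ≡ f 0 + (f 1 + Σl middle f) + f K
  Σn-split-ends f = cong (_+ f K) (trans (Σn-head r′ f) (cong (f 0 +_) (Σn-iterate r′ 1 f)))
    where
    Σn-iterate : ∀ k a (f : ℕ → ℕ) → Σn k (λ i → f (a + i)) ≡ f a + Σl (iterate suc (suc a) k) f
    Σn-iterate zero    a f = trans (cong f (+-identityʳ a)) (sym (+-identityʳ (f a)))
    Σn-iterate (suc k) a f = trans (Σn-head k (λ i → f (a + i)))
      (cong₂ _+_ (cong f (+-identityʳ a)) (trans (Σn-cong k (λ i _ → cong f (+-suc a i))) (Σn-iterate k (suc a) f)))

  middle-index : All (λ j → Σ ℕ (λ i → (j ≡ suc (suc i)) × (suc (suc i) ≤ r))) middle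
  middle-index = All.map (λ {j} (2≤j , j<) → index j 2≤j j<) (iterate-suc-bounds 2 r′)
    where
    index : ∀ j → 2 ≤ j → j < 2 + r′ → Σ ℕ (λ i → (j ≡ suc (suc i)) × (suc (suc i) ≤ r))
    index (suc (suc i)) (s≤s (s≤s _)) j< = i , refl , ≤-pred j<

  onceIn-τ-terms : ∀ {a b N} γ δ → Bounded a γ → Bounded b δ → a + b < N →
    ind (avoids p132 γ ∧ avoids p132 δ) * ind (onceIn τ (shift b γ ++ N ∷ δ))
    ≡ g₀ γ * h₀ δ + (g₁ γ * h₁ δ + Σl middle (λ j → gⱼ j γ * hⱼ j δ)) + gK γ * hK δ
  onceIn-τ-terms {b = b} {N = N} γ δ bγ bδ a+b<N = begin
    ind (avoids p132 γ ∧ avoids p132 δ) * ind (onceIn τ (shift b γ ++ N ∷ δ))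
      ≡⟨ cong₂ _*_ (ind-∧ (avoids p132 γ) (avoids p132 δ)) onceIn-τ-split ⟩
    Aγ * Aδ * Σn K term
      ≡⟨ cong (Aγ * Aδ *_) (Σn-split-ends term) ⟩
    Aγ * Aδ * (term 0 + (term 1 + Σl middle term) + term K)
      ≡⟨ distrib (Aγ * Aδ) (term 0) (term 1) (Σl middle term) (term K) ⟩
    Aγ * Aδ * term 0 + (Aγ * Aδ * term 1 + Aγ * Aδ * Σl middle term) + Aγ * Aδ * term K
      ≡⟨ cong (λ z → Aγ * Aδ * term 0 + (Aγ * Aδ * term 1 + z) + Aγ * Aδ * term K) (sym (Σl-*ˡ middle (Aγ * Aδ) term)) ⟩
    Aγ * Aδ * term 0 + (Aγ * Aδ * term 1 + Σl middle (λ j → Aγ * Aδ * term j)) + Aγ * Aδ * term K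
      ≡⟨ cong₂ _+_ (cong₂ _+_ term-0 (cong₂ _+_ term-1 (Σl-cong-All middle-index (λ j (i , j≡ , j≤r) → middle-term j≡ j≤r)))) term-K ⟩
    g₀ γ * h₀ δ + (g₁ γ * h₁ δ + Σl middle (λ j → gⱼ j γ * hⱼ j δ)) + gK γ * hK δ ∎
    where
    open ≡-Reasoning
    open Split bγ bδ a+b<N
    open Terms bγ bδ a+b<N
    distrib : ∀ c x y z w → c * (x + (y + z) + w) ≡ c * x + (c * y + c * z) + c * w
    distrib = solve-∀
    middle-term : ∀ {j i} → j ≡ suc (suc i) → suc (suc i) ≤ r → Aγ * Aδ * term j ≡ gⱼ j γ * hⱼ j δ
    middle-term {i = i} refl j≤r = term-j i j≤r

  Σ-perms-terms : ∀ (Lγ Lδ : List (List ℕ)) →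
    Σl Lγ (λ γ → Σl Lδ (λ δ → g₀ γ * h₀ δ + (g₁ γ * h₁ δ + Σl middle (λ j → gⱼ j γ * hⱼ j δ)) + gK γ * hK δ))
    ≡ Σl Lγ g₀ * Σl Lδ h₀ + (Σl Lγ g₁ * Σl Lδ h₁ + Σl middle (λ j → Σl Lγ (gⱼ j) * Σl Lδ (hⱼ j))) + Σl Lγ gK * Σl Lδ hK
  Σ-perms-terms Lγ Lδ =
    trans (ΣΣ-distrib-+ Lγ Lδ _ _)
    (cong₂ _+_ (trans (ΣΣ-distrib-+ Lγ Lδ _ _)
      (cong₂ _+_ (Σl-product Lγ Lδ g₀ h₀)
        (trans (ΣΣ-distrib-+ Lγ Lδ _ _)
          (cong₂ _+_ (Σl-product Lγ Lδ g₁ h₁)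
            (trans (Σl-cong Lγ (λ γ → Σl-swap Lδ middle (λ δ j → gⱼ j γ * hⱼ j δ)))
            (trans (Σl-swap Lγ middle (λ γ j → Σl Lδ (λ δ → gⱼ j γ * hⱼ j δ)))
                   (Σl-cong middle (λ j → Σl-product Lγ Lδ (gⱼ j) (hⱼ j)))))))))
      (Σl-product Lγ Lδ gK hK))

  gCount-suc : ∀ n → Σperms h₀ (suc n)
    ≡ conv (Σperms g₀) (Σperms h₀) n
      + (conv (Σperms g₁) (Σperms h₁) n + Σl middle (λ j → conv (Σperms (gⱼ j)) (Σperms (hⱼ j)) n))
      + conv (Σperms h₀) (Σperms hK) n
  gCount-suc n = begin
    Σperms h₀ (suc n)
      ≡⟨ Σl-cong (perms (suc n)) (λ α → sym (ind-∧ (avoids p132 α) (onceIn τ α))) ⟩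
    Σl (perms (suc n)) (λ α → ind (avoids p132 α ∧ onceIn τ α))
      ≡⟨ sym (count≡Σ _ (suc n)) ⟩
    count (λ α → avoids p132 α ∧ onceIn τ α) (suc n)
      ≡⟨ count132-max-split n (onceIn τ) ⟩
    Σn n (λ a → Σl (perms a) (λ γ → Σl (perms (n ∸ a)) (λ δ →
      ind (avoids p132 γ ∧ avoids p132 δ) * ind (onceIn τ (shift (n ∸ a) γ ++ suc n ∷ δ)))))
      ≡⟨ Σn-cong n (λ a a≤n → trans
           (Σl-cong-All (perms-bounded a) (λ γ bγ → Σl-cong-All (perms-bounded (n ∸ a)) (λ δ bδ →
              onceIn-τ-terms γ δ bγ bδ (s≤s (≤-reflexive (m+[n∸m]≡n a≤n))))))
           (Σ-perms-terms (perms a) (perms (n ∸ a)))) ⟩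
    Σn n (λ a → X a + (Y a + Z a) + W a)
      ≡⟨ Σn-distrib-+ n (λ a → X a + (Y a + Z a)) W ⟩
    Σn n (λ a → X a + (Y a + Z a)) + Σn n W
      ≡⟨ cong (_+ Σn n W) (trans (Σn-distrib-+ n X (λ a → Y a + Z a)) (cong (Σn n X +_)
           (trans (Σn-distrib-+ n Y Z) (cong (Σn n Y +_) (Σn-Σl n middle (λ j a → Σperms (gⱼ j) a * Σperms (hⱼ j) (n ∸ a))))))) ⟩
    conv (Σperms g₀) (Σperms h₀) n
      + (conv (Σperms g₁) (Σperms h₁) n + Σl middle (λ j → conv (Σperms (gⱼ j)) (Σperms (hⱼ j)) n))
      + conv (Σperms h₀) (Σperms hK) n ∎
    where
    open ≡-Reasoning
    X Y Z W : ℕ → ℕ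
    X a = Σperms g₀ a * Σperms h₀ (n ∸ a)
    Y a = Σperms g₁ a * Σperms h₁ (n ∸ a)
    Z a = Σl middle (λ j → Σperms (gⱼ j) a * Σperms (hⱼ j) (n ∸ a))
    W a = Σperms h₀ a * Σperms hK (n ∸ a)

  F₁ H₁ : PS
  F₁ = Gρ ρ₁ τ₁
  H₁ = Gρ τ (suffixPattern 1)

  Fⱼ⊛Hⱼ : ℕ → PS
  Fⱼ⊛Hⱼ j = Gρ (layered (map (λ i → m i ∸ m (suc j)) (range 0 j))) (layered (map (λ i → m i ∸ m j) (range 0 (j ∸ 1))))
           ⊛ Gρ (layered (map m (range (j ∸ 1) r))) (layered (map m (range j r)))

  -- p₁ = 1 means that γ contains 12⋯(d-1) exactly once, since an occurrence of 12⋯d yields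
  -- two of them.
  onceIn-τ₁ : ∀ e → d′ ≡ suc e → ∀ γ → ind (onceIn τ₁ γ) ≡ ind ((occ (iterate suc 1 d) γ + occ (iterate suc 1 d′) γ) ==ℕ 1)
  onceIn-τ₁ e d′≡ γ = sym (trans
    (==ℕ1-+-implied (occ (iterate suc 1 d) γ) (occ (iterate suc 1 d′) γ) (λ occ>0 →
       subst (λ z → 2 ≤ occ (iterate suc 1 z) γ) (sym d′≡)
             (increasing-occ-doubles e γ (subst (λ z → 1 ≤ occ (iterate suc 1 z) γ) (trans d≡suc-d′ (cong suc d′≡)) occ>0))))
    (cong (λ z → ind (occ z γ ==ℕ 1)) (sym (layered-single d′))))

  -- For d = 1 the pattern τ₁ is empty, where Gρ is 1 by convention.
  Σperms-g₁≡1S : d′ ≡ 0 → ⟦ Σperms g₁ ⟧ ≋ 1S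
  Σperms-g₁≡1S d′≡0 zero = cong ℤ.+_ (trans (+-identityʳ _)
    (cong₂ (λ u v → ind (avoids p132 []) * (ind (u ==ℕ 0) * ind (v ==ℕ 1)))
           (occ-nonempty-[] ρ₁ (stdPrefix-nonempty 2 (s≤s z≤n) (s≤s (s≤s z≤n))))
           (cong₂ _+_ (occ-nonempty-[] (iterate suc 1 d) (subst (0 <_) (sym (trans (length-iterate suc 1 d) d≡1)) (s≤s z≤n)))
                      (trans (cong (λ z → occ (iterate suc 1 z) []) d′≡0) (occ-[] [])))))
    where
    d≡1 : d ≡ 1
    d≡1 = trans d≡suc-d′ (cong suc d′≡0)
    occ-nonempty-[] : ∀ σ → 0 < length σ → occ σ [] ≡ 0
    occ-nonempty-[] (_ ∷ _) _ = refl
  Σperms-g₁≡1S d′≡0 (suc k) = cong ℤ.+_ (Σ-g₁-nonempty (perms (suc k)) (perms-length (suc k)))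
    where
    d≡1 : d ≡ 1
    d≡1 = trans d≡suc-d′ (cong suc d′≡0)
    one-plus-positive : ∀ x → 1 ≤ x → ind ((x + 1) ==ℕ 1) ≡ 0
    one-plus-positive (suc x) _ rewrite +-comm x 1 = refl
    g₁-nonempty : ∀ c γ → g₁ (c ∷ γ) ≡ 0
    g₁-nonempty c γ = begin
      ind (avoids p132 (c ∷ γ)) * (ind (avoids ρ₁ (c ∷ γ)) * ind ((occ (iterate suc 1 d) (c ∷ γ) + occ (iterate suc 1 d′) (c ∷ γ)) ==ℕ 1))
        ≡⟨ cong (λ u → ind (avoids p132 (c ∷ γ)) * (ind (avoids ρ₁ (c ∷ γ)) * ind (u ==ℕ 1)))
                (cong₂ _+_ (cong (λ w → occ (iterate suc 1 w) (c ∷ γ)) d≡1)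
                           (trans (cong (λ w → occ (iterate suc 1 w) (c ∷ γ)) d′≡0) (occ-[] (c ∷ γ)))) ⟩
      ind (avoids p132 (c ∷ γ)) * (ind (avoids ρ₁ (c ∷ γ)) * ind ((occ (1 ∷ []) (c ∷ γ) + 1) ==ℕ 1))
        ≡⟨ cong (λ u → ind (avoids p132 (c ∷ γ)) * (ind (avoids ρ₁ (c ∷ γ)) * u))
                (one-plus-positive (occ (1 ∷ []) (c ∷ γ)) (occ-pos (1 ∷ []) (refl ∷ []⊆-universal γ) refl)) ⟩
      ind (avoids p132 (c ∷ γ)) * (ind (avoids ρ₁ (c ∷ γ)) * 0)
        ≡⟨ trans (cong (ind (avoids p132 (c ∷ γ)) *_) (*-zeroʳ (ind (avoids ρ₁ (c ∷ γ))))) (*-zeroʳ (ind (avoids p132 (c ∷ γ)))) ⟩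
      0 ∎
      where open ≡-Reasoning
    Σ-g₁-nonempty : ∀ L → All (λ γ → length γ ≡ suc k) L → Σl L g₁ ≡ 0
    Σ-g₁-nonempty []            []        = refl
    Σ-g₁-nonempty ((c ∷ γ) ∷ L) (_ ∷ |L|) = cong₂ _+_ (g₁-nonempty c γ) (Σ-g₁-nonempty L |L|)

  F₁≋ : F₁ ≋ ⟦ Σperms g₁ ⟧
  F₁≋ = by-d′ d′ refl
    where
    by-d′ : ∀ x → x ≡ d′ → F₁ ≋ ⟦ Σperms g₁ ⟧
    by-d′ zero    0≡d′   k = trans (cong (λ z → Gρ ρ₁ (layered (z ∷ [])) k) (sym 0≡d′)) (sym (Σperms-g₁≡1S (sym 0≡d′) k))
    by-d′ (suc e) e+1≡d′ k =
      trans (Gρ-nonempty ρ₁ τ₁ (subst (λ z → 0 < length (layered (z ∷ []))) e+1≡d′ τ₁-nonempty) k)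
            (cong ℤ.+_ (Σl-cong (perms k) (λ γ →
               cong (λ z → ind (avoids p132 γ) * (ind (avoids ρ₁ γ) * z)) (onceIn-τ₁ e (sym e+1≡d′) γ))))
      where
      τ₁-nonempty : 0 < length (layered (suc e ∷ []))
      τ₁-nonempty = subst (λ z → 0 < length z) (sym (layered-single (suc e)))
                          (subst (0 <_) (sym (length-iterate suc 1 (suc e))) (s≤s z≤n))

  H₁≋ : H₁ ≋ ⟦ Σperms h₁ ⟧
  H₁≋ = Gρ-nonempty τ (suffixPattern 1) (suffixPattern-nonempty 1 (s≤s z≤n))

  Fⱼ⊛Hⱼ≋ : ∀ j → 2 ≤ j → j ≤ r → Fⱼ⊛Hⱼ j ≋ ⟦ conv (Σperms (gⱼ j)) (Σperms (hⱼ j)) ⟧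
  Fⱼ⊛Hⱼ≋ j 2≤j j≤r = ⊛-⟦⟧ (Σperms (gⱼ j)) (Σperms (hⱼ j))
    (Gρ-nonempty (stdPrefix (suc j)) (stdPrefix j) (stdPrefix-nonempty j (≤-trans (s≤s z≤n) 2≤j) (≤-trans j≤r (n≤1+n r))))
    (Gρ-nonempty (suffixPattern (j ∸ 1)) (suffixPattern j) (suffixPattern-nonempty j j≤r))

  G-τ-zero : G τ 0 ≡ ℤ.+ 0
  G-τ-zero = trans (G≋ τ 0) (cong (λ z → ℤ.+ (ind (avoids p132 []) * ind (z ==ℕ 1) + 0))
    (occ-nonempty-[] τ (subst (λ z → 0 < length z) (sym τ≡prefix) (prefix-nonempty r ≤-refl))))
    where
    occ-nonempty-[] : ∀ σ → 0 < length σ → occ σ [] ≡ 0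
    occ-nonempty-[] (_ ∷ _) _ = refl

  G-recurrence : G τ ≋ xS (R d′ ⊛ G τ ⊕ (F₁ ⊛ H₁ ⊕ ΣS (range 2 r) Fⱼ⊛Hⱼ) ⊕ G τ ⊛ R (m r))
  G-recurrence zero    = G-τ-zero
  G-recurrence (suc n) = begin
    G τ (suc n)
      ≡⟨ G≋ τ (suc n) ⟩
    ℤ.+ Σperms h₀ (suc n)
      ≡⟨ cong ℤ.+_ (gCount-suc n) ⟩
    ℤ.+ (c₀ + (c₁ + cₘ) + cK)
      ≡⟨ trans (ℤₚ.pos-+ (c₀ + (c₁ + cₘ)) cK)
               (cong (ℤ._+ ℤ.+ cK) (trans (ℤₚ.pos-+ c₀ (c₁ + cₘ)) (cong (ℤ._+_ (ℤ.+ c₀)) (ℤₚ.pos-+ c₁ cₘ)))) ⟩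
    ℤ.+ c₀ ℤ.+ (ℤ.+ c₁ ℤ.+ ℤ.+ cₘ) ℤ.+ ℤ.+ cK
      ≡⟨ sym (cong₂ ℤ._+_ (cong₂ ℤ._+_ (⊛-⟦⟧ (Σperms g₀) (Σperms h₀) (R≋ d′) (G≋ τ) n)
                                       (cong₂ ℤ._+_ (⊛-⟦⟧ (Σperms g₁) (Σperms h₁) F₁≋ H₁≋ n) middle-terms))
                          (⊛-⟦⟧ (Σperms h₀) (Σperms hK) (G≋ τ) (R≋ (m r)) n)) ⟩
    (R d′ ⊛ G τ) n ℤ.+ ((F₁ ⊛ H₁) n ℤ.+ ΣS (range 2 r) Fⱼ⊛Hⱼ n) ℤ.+ (G τ ⊛ R (m r)) n ∎
    where
    open ≡-Reasoning
    c₀ = conv (Σperms g₀) (Σperms h₀) n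
    c₁ = conv (Σperms g₁) (Σperms h₁) n
    cₘ = Σl middle (λ j → conv (Σperms (gⱼ j)) (Σperms (hⱼ j)) n)
    cK = conv (Σperms h₀) (Σperms hK) n
    middle-terms : ΣS (range 2 r) Fⱼ⊛Hⱼ n ≡ ℤ.+ cₘ
    middle-terms = trans (cong (λ L → ΣS L Fⱼ⊛Hⱼ n) (range≡iterate 2 r))
      (ΣS-⟦⟧ middle Fⱼ⊛Hⱼ (λ j → conv (Σperms (gⱼ j)) (Σperms (hⱼ j))) (iterate-suc-bounds 2 r′)
             (λ j (2≤j , j<) → Fⱼ⊛Hⱼ≋ j 2≤j (≤-pred j<)) n)

theorem3p3 : (r : ℕ) → 1 ≤ r → (m : ℕ → ℕ) →
  (∀ i → i ≤ r → m (suc i) < m i) → m (suc r) ≡ 0 →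
  ∀ n →
    ((1S ⊖ xS (R ((m 0 ∸ m 1) ∸ 1)) ⊖ xS (R (m r)))
      ⊛ G (layered (map m (range 0 r)))) n
    ≡
    (xS (Gρ (layered ((m 0 ∸ m 2) ∷ (m 1 ∸ m 2) ∷ []))
            (layered (((m 0 ∸ m 1) ∸ 1) ∷ []))
         ⊛ Gρ (layered (map m (range 0 r))) (layered (map m (range 1 r))))
     ⊕ xS (ΣS (range 2 r) (λ j →
         Gρ (layered (map (λ i → m i ∸ m (suc j)) (range 0 j)))
            (layered (map (λ i → m i ∸ m j) (range 0 (j ∸ 1))))
         ⊛ Gρ (layered (map m (range (j ∸ 1) r)))
              (layered (map m (range j r)))))) n
theorem3p3 zero     () m m-dec m-last n
theorem3p3 (suc r′) _  m m-dec m-last n =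
  trans (⊛-solve-linear (R d′) (F₁ ⊛ H₁ ⊕ ΣS (range 2 r) Fⱼ⊛Hⱼ) (R (m r)) (G τ) G-recurrence n)
        (xS-distrib-⊕ (F₁ ⊛ H₁) (ΣS (range 2 r) Fⱼ⊛Hⱼ) n)
  where open Layers r′ m m-dec m-last
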